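{- Let $$S(t,p,q,x,y,u,v)=\sum_{\pi}t^{|\pi|}p^{\mathrm{asc}(\pi)}q^{\mathrm{des}(\pi)}x^{\mathrm{lmax}(\pi)}y^{\mathrm{rmax}(\pi)}u^{\mathrm{lmin}(\pi)}v^{\mathrm{rmin}(\pi)},$$ the sum over all separable permutations $\pi$, and let $I(t,p,q,x,y,u,v)$ be the same sum restricted to irreducible separable permutations. Then $$S(t,p,q,x,y,u,v)=xyuvt+p\,S(t,p,q,x,1,u,v)\,I(t,p,q,x,y,1,v)+q\big(S(t,p,q,x,y,u,1)-I(t,p,q,x,y,u,1)+xyut\big)S(t,p,q,1,y,u,v),$$ and $$I(t,p,q,x,y,u,v)=xyuvt+q\big(S(t,p,q,x,y,u,1)-I(t,p,q,x,y,u,1)+xyut\big)S(t,p,q,1,y,u,v).$$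
   Context: A permutation of length $n$ is a word $\pi=\pi_1\cdots\pi_n$ rearranging $\{1,\dots,n\}$; $|\pi|=n$. For $\pi\in S_m,\sigma\in S_n$: $\pi\oplus\sigma=\pi_1\cdots\pi_m(\sigma_1+m)\cdots(\sigma_n+m)$, $\pi\ominus\sigma=(\pi_1+n)\cdots(\pi_m+n)\sigma_1\cdots\sigma_n$. Separable permutations are those obtainable from $1$ by repeatedly applying $\oplus$ and $\ominus$ (equivalently, nonempty permutations avoiding $2413$ and $3142$). A permutation $\pi_1\cdots\pi_n$ with $n\ge2$ is irreducible if there is no $i$ with $2\le i\le n$ such that every element of $\pi_1\cdots\pi_{i-1}$ is smaller than every element of $\pi_i\cdots\pi_n$; the permutation $1$ is irreducible by definition. $\mathrm{des}(\pi)$ (resp. $\mathrm{asc}(\pi)$) is the number of $i\in\{1,\dots,n-1\}$ with $\pi_i>\pi_{i+1}$ (resp. $\pi_i<\pi_{i+1}$). $\pi_i$ is a left-to-right maximum (resp. minimum) if $\pi_i>\pi_j$ (resp. $<$) for all $j<i$, and a right-to-left maximum (resp. minimum) if $\pi_i>\pi_j$ (resp. $<$) for all $j>i$; $\mathrm{lmax},\mathrm{lmin},\mathrm{rmax},\mathrm{rmin}$ count these. The generating functions are formal power series in $t$. -}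

module Defs where

open import Level using (Level)
open import Data.Nat using (ℕ; zero; suc; _∸_; _<ᵇ_; _≡ᵇ_) renaming (_+_ to _+ℕ_)
open import Data.Bool using (Bool; true; false; _∧_; _∨_; not; if_then_else_)
open import Data.List using (List; []; _∷_; [_]; _++_; map; concatMap; length; take; drop; reverse; upTo; foldr)
open import Algebra.Bundles using (CommutativeRing)

-- Permutations are words (lists) over ℕ with letters 1..n.

allB : {A : Set} → (A → Bool) → List A → Bool
allB P []       = true
allB P (a ∷ as) = P a ∧ allB P as

anyB : {A : Set} → (A → Bool) → List A → Bool
anyB P []       = false
anyB P (a ∷ as) = P a ∨ anyB P as

filterB : {A : Set} → (A → Bool) → List A → List A
filterB P []       = []
filterB P (a ∷ as) = if P a then a ∷ filterB P as else filterB P as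

countB : {A : Set} → (A → Bool) → List A → ℕ
countB P []       = 0
countB P (a ∷ as) = (if P a then 1 else 0) +ℕ countB P as

oneTo : ℕ → List ℕ
oneTo n = map suc (upTo n)

words : ℕ → ℕ → List (List ℕ)
words n zero    = [] ∷ []
words n (suc k) = concatMap (λ w → map (λ a → a ∷ w) (oneTo n)) (words n k)

isPerm : ℕ → List ℕ → Bool
isPerm n w = allB (λ i → countB (λ a → a ≡ᵇ i) w ≡ᵇ 1) (oneTo n)

perms : ℕ → List (List ℕ)
perms n = filterB (isPerm n) (words n n)

allLess : List ℕ → List ℕ → Bool
allLess xs ys = allB (λ a → allB (λ b → a <ᵇ b) ys) xs

std : List ℕ → List ℕ
std w = map (λ a → suc (countB (λ b → b <ᵇ a) w)) w

-- Separable permutations: obtainable from 1 by ⊕ and ⊖.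
-- π is separable iff π = 1, or π = α ⊕ β or π = α ⊖ β with α, β
-- (nonempty) separable.  A split π = (prefix of length k)(rest) with
-- 1 ≤ k < |π| is α ⊕ β iff prefix < rest elementwise (then α, β are the
-- standardisations of the two parts); it is α ⊖ β iff prefix > rest.
-- The fuel argument is the length (parts are strictly shorter).

sepF : ℕ → List ℕ → Bool
sepF zero    π = false
sepF (suc f) π =
  isOne π ∨ anyB split (upTo (length π))
  where
  isOne : List ℕ → Bool
  isOne (1 ∷ []) = true
  isOne _        = false
  split : ℕ → Bool
  split k =
    let a = take k π ; b = drop k π in
    not (k ≡ᵇ 0) ∧ (not (length b ≡ᵇ 0) ∧
      ((allLess a b ∨ allLess b a) ∧ (sepF f (std a) ∧ sepF f (std b))))

isSep : List ℕ → Bool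
isSep π = sepF (length π) π

-- Irreducible: no i with 2 ≤ i ≤ n such that π₁⋯π_{i-1} < π_i⋯π_n
-- elementwise (k = i - 1 ranges over 1..n-1).  For π = 1 this holds
-- vacuously, matching the convention that 1 is irreducible.
isIrr : List ℕ → Bool
isIrr π = not (anyB (λ k → not (k ≡ᵇ 0) ∧ allLess (take k π) (drop k π))
                    (upTo (length π)))

adjCount : (ℕ → ℕ → Bool) → List ℕ → ℕ
adjCount R []           = 0
adjCount R (a ∷ [])     = 0
adjCount R (a ∷ b ∷ as) = (if R a b then 1 else 0) +ℕ adjCount R (b ∷ as)

asc : List ℕ → ℕ
asc = adjCount (λ a b → a <ᵇ b)

des : List ℕ → ℕ
des = adjCount (λ a b → b <ᵇ a)

leftRecords : (ℕ → ℕ → Bool) → List ℕ → List ℕ → ℕ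
leftRecords R acc []       = 0
leftRecords R acc (a ∷ as) =
  (if allB (λ b → R b a) acc then 1 else 0) +ℕ leftRecords R (acc ++ [ a ]) as

lmax lmin rmax rmin : List ℕ → ℕ
lmax π = leftRecords (λ b a → b <ᵇ a) [] π
lmin π = leftRecords (λ b a → a <ᵇ b) [] π
rmax π = lmax (reverse π)
rmin π = lmin (reverse π)

-- Coefficients of t^n of the generating functions S and I, as
-- polynomial functions of p,q,x,y,u,v over an arbitrary commutative ring.

module GF {c ℓ : Level} (R : CommutativeRing c ℓ) where
  open CommutativeRing R

  pow : Carrier → ℕ → Carrier
  pow a zero    = 1#
  pow a (suc k) = a * pow a k

  sumR : List Carrier → Carrier
  sumR = foldr _+_ 0#

  weight : (p q x y u v : Carrier) → List ℕ → Carrier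
  weight p q x y u v π =
    pow p (asc π) * (pow q (des π) * (pow x (lmax π) * (pow y (rmax π)
      * (pow u (lmin π) * pow v (rmin π)))))

  Sc : ℕ → (p q x y u v : Carrier) → Carrier
  Sc n p q x y u v = sumR (map (weight p q x y u v) (filterB isSep (perms n)))

  Ic : ℕ → (p q x y u v : Carrier) → Carrier
  Ic n p q x y u v =
    sumR (map (weight p q x y u v) (filterB (λ π → isSep π ∧ isIrr π) (perms n)))

  conv : (ℕ → Carrier) → (ℕ → Carrier) → ℕ → Carrier
  conv f g n = sumR (map (λ i → f i * g (n ∸ i)) (upTo (suc n)))

  monoT : Carrier → ℕ → Carrier
  monoT a n = if n ≡ᵇ 1 then a else 0#

-- A separable π ≠ 1 is a direct sum or a skew sum of separable permutations, never both.
-- Cutting a reducible π at its last ⊕ cut writes it uniquely as α ⊕ β with β irreducible;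
-- cutting an irreducible π ≠ 1 at its first ⊖ cut writes it uniquely as α ⊖ β with α equal
-- to 1 or reducible, and such α have generating function S − I + xyut at v = 1. In α ⊕ β
-- one ascent is created, left-to-right maxima and right-to-left minima of both blocks
-- survive, right-to-left maxima come only from β and left-to-right minima only from α;
-- dually for α ⊖ β. Coefficientwise these are finite sums over the enumeration perms n,
-- and the bijections cut a word and standardise its two parts.

module Submission where

open import Defs
open import Data.Nat using (ℕ)
open import Data.Product using (_×_; _,_)
open import Algebra.Bundles using (CommutativeRing)

module Permutations where

  open import Data.Nat using (ℕ; zero; suc; _+_; _*_; _∸_; _≤_; _<_; z≤n; s≤s; _<ᵇ_; _≡ᵇ_; _⊓_; _⊔_)
  open import Data.Nat.Properties
  open import Data.Nat.ListAction using (sum)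
  open import Data.Nat.ListAction.Properties using (sum-++)
  open import Data.Bool using (Bool; true; false; _∧_; _∨_; not; if_then_else_; T)
  open import Data.Bool.Properties using (∨-zeroʳ; ∧-identityʳ; ∧-zeroʳ)
  open import Data.Unit using (⊤; tt)
  open import Data.List using (List; []; _∷_; [_]; _++_; map; length; take; drop; reverse; upTo; concatMap)
  open import Data.List.Properties using (++-assoc; ++-identityʳ; map-++; length-++; length-map; take++drop≡id; map-∘; map-id; length-take; length-drop; take-map; drop-map; drop-drop; take-drop; take-[]; upTo-∷ʳ; length-upTo; reverse-++; reverse-map)
  open import Data.List.Membership.Propositional using (_∈_; _∉_)
  open import Data.List.Relation.Binary.Subset.Propositional using (_⊆_)
  open import Data.List.Membership.Propositional.Properties using (∈-++⁺ˡ; ∈-++⁺ʳ; ∈-++⁻; ∈-map⁺; ∈-map⁻; ∈-upTo⁺; ∈-upTo⁻)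
  open import Data.List.Relation.Unary.Any using (here; there)
  import Data.List.Relation.Unary.Any.Properties as AnyP
  open import Relation.Binary.PropositionalEquality hiding ([_])
  open ≡-Reasoning
  open import Relation.Nullary using (¬_)
  open import Data.Product using (Σ; _×_; _,_; proj₁; proj₂)
  open import Data.Sum using (_⊎_; inj₁; inj₂)
  open import Data.Empty using (⊥; ⊥-elim)
  open import Relation.Binary.Definitions using (tri<; tri≈; tri>)
  open import Algebra.Properties.CommutativeSemigroup +-commutativeSemigroup using () renaming (interchange to +-interchange)

  true≢false : true ≢ false
  true≢false ()

  ∧-true⁻ : ∀ {a b} → a ∧ b ≡ true → a ≡ true × b ≡ true
  ∧-true⁻ {true} {true} _ = refl , refl

  ∧-true⁺ : ∀ {a b} → a ≡ true → b ≡ true → a ∧ b ≡ true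
  ∧-true⁺ refl refl = refl

  ∨-true⁻ : ∀ {a b} → a ∨ b ≡ true → a ≡ true ⊎ b ≡ true
  ∨-true⁻ {true} _ = inj₁ refl
  ∨-true⁻ {false} h = inj₂ h

  ∨-true⁺ʳ : ∀ {a b} → b ≡ true → a ∨ b ≡ true
  ∨-true⁺ʳ {a} refl = ∨-zeroʳ a

  ∨-true⁺ˡ : ∀ {a b} → a ≡ true → a ∨ b ≡ true
  ∨-true⁺ˡ refl = refl

  not-true⁻ : ∀ {a} → not a ≡ true → a ≡ false
  not-true⁻ {false} _ = refl

  not-false⁻ : ∀ {a} → not a ≡ false → a ≡ true
  not-false⁻ {true} _ = refl

  false≢true : false ≢ true
  false≢true ()

  T⇒≡true : ∀ {b} → T b → b ≡ true
  T⇒≡true {true} _ = refl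

  ≡true⇒T : ∀ {b} → b ≡ true → T b
  ≡true⇒T refl = tt

  <ᵇ-true⇒< : ∀ {a b} → (a <ᵇ b) ≡ true → a < b
  <ᵇ-true⇒< {a} {b} h = <ᵇ⇒< a b (≡true⇒T h)

  <⇒<ᵇ-true : ∀ {a b} → a < b → (a <ᵇ b) ≡ true
  <⇒<ᵇ-true h = T⇒≡true (<⇒<ᵇ h)

  ≮⇒<ᵇ-false : ∀ {a b} → ¬ (a < b) → (a <ᵇ b) ≡ false
  ≮⇒<ᵇ-false {a} {b} h with a <ᵇ b in eq
  ... | true = ⊥-elim (h (<ᵇ-true⇒< eq))
  ... | false = refl

  <ᵇ-false⇒≮ : ∀ {a b} → (a <ᵇ b) ≡ false → ¬ (a < b)
  <ᵇ-false⇒≮ h lt = false≢true (trans (sym h) (<⇒<ᵇ-true lt))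

  ≡ᵇ-true⇒≡ : ∀ {a b} → (a ≡ᵇ b) ≡ true → a ≡ b
  ≡ᵇ-true⇒≡ {a} {b} h = ≡ᵇ⇒≡ a b (≡true⇒T h)

  ≡⇒≡ᵇ-true : ∀ {a b} → a ≡ b → (a ≡ᵇ b) ≡ true
  ≡⇒≡ᵇ-true {a} {b} h = T⇒≡true (≡⇒≡ᵇ a b h)

  ≢⇒≡ᵇ-false : ∀ {a b} → a ≢ b → (a ≡ᵇ b) ≡ false
  ≢⇒≡ᵇ-false {a} {b} h with a ≡ᵇ b in eq
  ... | true = ⊥-elim (h (≡ᵇ-true⇒≡ eq))
  ... | false = refl

  n<ᵇn≡false : ∀ n → (n <ᵇ n) ≡ false
  n<ᵇn≡false n = ≮⇒<ᵇ-false (n≮n n)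

  take-⊆ : ∀ {A : Set} k (w : List A) → take k w ⊆ w
  take-⊆ zero w ()
  take-⊆ (suc k) [] ()
  take-⊆ (suc k) (a ∷ w) (here p) = here p
  take-⊆ (suc k) (a ∷ w) (there m) = there (take-⊆ k w m)

  drop-⊆ : ∀ {A : Set} k (w : List A) → drop k w ⊆ w
  drop-⊆ zero w m = m
  drop-⊆ (suc k) [] ()
  drop-⊆ (suc k) (a ∷ w) m = there (drop-⊆ k w m)

  allB-∈ : ∀ {A : Set} {P : A → Bool} {L} → allB P L ≡ true → ∀ {x} → x ∈ L → P x ≡ true
  allB-∈ {P = P} {a ∷ L} h (here refl) with P a | h
  ... | true | _ = refl
  allB-∈ {P = P} {a ∷ L} h (there m) with P a | h
  ... | true | h' = allB-∈ h' m

  allB-intro : ∀ {A : Set} {P : A → Bool} L → (∀ {x} → x ∈ L → P x ≡ true) → allB P L ≡ true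
  allB-intro [] h = refl
  allB-intro {P = P} (a ∷ L) h rewrite h (here refl) = allB-intro L (λ m → h (there m))

  allB-false : ∀ {A : Set} {P : A → Bool} {L x} → x ∈ L → P x ≡ false → allB P L ≡ false
  allB-false {P = P} {a ∷ L} (here refl) h rewrite h = refl
  allB-false {P = P} {a ∷ L} (there m) h with P a
  ... | true = allB-false m h
  ... | false = refl

  allB-cong : ∀ {A : Set} {P Q : A → Bool} L → (∀ {x} → x ∈ L → P x ≡ Q x) → allB P L ≡ allB Q L
  allB-cong [] h = refl
  allB-cong (a ∷ L) h = cong₂ _∧_ (h (here refl)) (allB-cong L (λ m → h (there m)))

  allB-map : ∀ {A B : Set} {P : B → Bool} (f : A → B) L → allB P (map f L) ≡ allB (λ x → P (f x)) L
  allB-map f [] = refl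
  allB-map {P = P} f (a ∷ L) = cong (P (f a) ∧_) (allB-map f L)

  allB-++ : ∀ {A : Set} {P : A → Bool} L M → allB P (L ++ M) ≡ allB P L ∧ allB P M
  allB-++ [] M = refl
  allB-++ {P = P} (a ∷ L) M rewrite allB-++ {P = P} L M with P a
  ... | true = refl
  ... | false = refl

  anyB-intro : ∀ {A : Set} {P : A → Bool} {L x} → x ∈ L → P x ≡ true → anyB P L ≡ true
  anyB-intro {P = P} {a ∷ L} (here refl) h rewrite h = refl
  anyB-intro {P = P} {a ∷ L} (there m) h with P a
  ... | true = refl
  ... | false = anyB-intro m h

  anyB-elim : ∀ {A : Set} {P : A → Bool} L → anyB P L ≡ true → Σ A λ x → x ∈ L × P x ≡ true
  anyB-elim {P = P} (a ∷ L) h with P a in eq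
  ... | true = a , here refl , eq
  ... | false with anyB-elim L h
  ... | x , m , e = x , there m , e

  anyB-cong : ∀ {A : Set} {P Q : A → Bool} L → (∀ {x} → x ∈ L → P x ≡ Q x) → anyB P L ≡ anyB Q L
  anyB-cong [] h = refl
  anyB-cong (a ∷ L) h = cong₂ _∨_ (h (here refl)) (anyB-cong L (λ m → h (there m)))

  countB-cong : ∀ {A : Set} {P Q : A → Bool} L → (∀ {x} → x ∈ L → P x ≡ Q x) → countB P L ≡ countB Q L
  countB-cong [] h = refl
  countB-cong (a ∷ L) h = cong₂ (λ b n → (if b then 1 else 0) + n) (h (here refl)) (countB-cong L (λ m → h (there m)))

  countB-map : ∀ {A B : Set} {P : B → Bool} (f : A → B) L → countB P (map f L) ≡ countB (λ x → P (f x)) L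
  countB-map f [] = refl
  countB-map {P = P} f (a ∷ L) = cong ((if P (f a) then 1 else 0) +_) (countB-map f L)

  countB-++ : ∀ {A : Set} {P : A → Bool} L M → countB P (L ++ M) ≡ countB P L + countB P M
  countB-++ [] M = refl
  countB-++ {P = P} (a ∷ L) M rewrite countB-++ {P = P} L M = sym (+-assoc (if P a then 1 else 0) _ _)

  countB-zero : ∀ {A : Set} {P : A → Bool} L → (∀ {x} → x ∈ L → P x ≡ false) → countB P L ≡ 0
  countB-zero [] h = refl
  countB-zero (a ∷ L) h rewrite h (here refl) = countB-zero L (λ m → h (there m))

  countB-all : ∀ {A : Set} {P : A → Bool} L → (∀ {x} → x ∈ L → P x ≡ true) → countB P L ≡ length L
  countB-all [] h = refl
  countB-all (a ∷ L) h rewrite h (here refl) = cong suc (countB-all L (λ m → h (there m)))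

  countB≤length : ∀ {A : Set} {P : A → Bool} L → countB P L ≤ length L
  countB≤length [] = z≤n
  countB≤length {P = P} (a ∷ L) with P a
  ... | true = s≤s (countB≤length L)
  ... | false = m≤n⇒m≤1+n (countB≤length L)

  countB<length : ∀ {A : Set} {P : A → Bool} L {x} → x ∈ L → P x ≡ false → countB P L < length L
  countB<length {P = P} (a ∷ L) (here refl) h rewrite h = s≤s (countB≤length L)
  countB<length {P = P} (a ∷ L) (there m) h with P a
  ... | true = s≤s (countB<length L m h)
  ... | false = m≤n⇒m≤1+n (countB<length L m h)

  countB-mono : ∀ {A : Set} {P Q : A → Bool} L → (∀ {x} → x ∈ L → P x ≡ true → Q x ≡ true) → countB P L ≤ countB Q L
  countB-mono [] h = z≤n
  countB-mono {P = P} {Q} (a ∷ L) h with P a in e1 | Q a in e2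
  ... | true | true = s≤s (countB-mono L (λ m → h (there m)))
  ... | true | false = ⊥-elim (true≢false (trans (sym (h (here refl) e1)) e2))
  ... | false | true = m≤n⇒m≤1+n (countB-mono L (λ m → h (there m)))
  ... | false | false = countB-mono L (λ m → h (there m))

  countB-mono-< : ∀ {A : Set} {P Q : A → Bool} L → (∀ {x} → x ∈ L → P x ≡ true → Q x ≡ true) →
    ∀ {y} → y ∈ L → P y ≡ false → Q y ≡ true → countB P L < countB Q L
  countB-mono-< {P = P} {Q} (a ∷ L) h (here refl) e1 e2 rewrite e1 | e2 = s≤s (countB-mono L (λ m → h (there m)))
  countB-mono-< {P = P} {Q} (a ∷ L) h (there m) f1 f2 with P a in e1 | Q a in e2
  ... | true | true = s≤s (countB-mono-< L (λ m → h (there m)) m f1 f2)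
  ... | true | false = ⊥-elim (true≢false (trans (sym (h (here refl) e1)) e2))
  ... | false | true = m≤n⇒m≤1+n (countB-mono-< L (λ m → h (there m)) m f1 f2)
  ... | false | false = countB-mono-< L (λ m → h (there m)) m f1 f2

  rank : List ℕ → ℕ → ℕ
  rank w a = suc (countB (λ b → b <ᵇ a) w)

  PreservesOrder : (ℕ → ℕ) → List ℕ → Set
  PreservesOrder h v = ∀ {a b} → a ∈ v → b ∈ v → (h a <ᵇ h b) ≡ (a <ᵇ b)

  PreservesOrder-⊆ : ∀ {u v} h → PreservesOrder h v → u ⊆ v → PreservesOrder h u
  PreservesOrder-⊆ h op s ma mb = op (s ma) (s mb)

  PreservesOrder-intro : ∀ {h : ℕ → ℕ} v → (∀ {a b} → a ∈ v → b ∈ v → a < b → h a < h b) → (∀ {a b} → a ∈ v → b ∈ v → ¬ a < b → ¬ h a < h b) → PreservesOrder h v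
  PreservesOrder-intro {h} v f g {a} {b} ma mb with a <ᵇ b in eq
  ... | true = <⇒<ᵇ-true (f ma mb (<ᵇ-true⇒< eq))
  ... | false = ≮⇒<ᵇ-false (g ma mb (<ᵇ-false⇒≮ eq))

  rank-preservesOrder : ∀ v → PreservesOrder (rank v) v
  rank-preservesOrder v = PreservesOrder-intro v f g
    where
    f : ∀ {a b} → a ∈ v → b ∈ v → a < b → rank v a < rank v b
    f {a} {b} ma mb lt = s≤s (countB-mono-< v (λ {x} _ e → <⇒<ᵇ-true (<-trans (<ᵇ-true⇒< e) lt)) ma (n<ᵇn≡false a) (<⇒<ᵇ-true lt))
    g : ∀ {a b} → a ∈ v → b ∈ v → ¬ a < b → ¬ rank v a < rank v b
    g {a} {b} ma mb nlt lt2 = <⇒≱ lt2 (s≤s (countB-mono v (λ {x} _ e → <⇒<ᵇ-true (<-≤-trans (<ᵇ-true⇒< e) (≮⇒≥ nlt)))))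

  +-preservesOrder : ∀ c v → PreservesOrder (λ x → x + c) v
  +-preservesOrder c v = PreservesOrder-intro v (λ _ _ lt → +-monoˡ-< c lt) (λ _ _ nlt lt → nlt (+-cancelʳ-< _ _ _ lt))

  map-cong-∈ : ∀ {A B : Set} {f g : A → B} L → (∀ {x} → x ∈ L → f x ≡ g x) → map f L ≡ map g L
  map-cong-∈ [] h = refl
  map-cong-∈ (a ∷ L) h = cong₂ _∷_ (h (here refl)) (map-cong-∈ L (λ m → h (there m)))

  map-id-∈ : ∀ {A : Set} {f : A → A} L → (∀ {x} → x ∈ L → f x ≡ x) → map f L ≡ L
  map-id-∈ L h = trans (map-cong-∈ L h) (map-id L)

  map-id⇒fixes : ∀ {A : Set} {f : A → A} L → map f L ≡ L → ∀ {x} → x ∈ L → f x ≡ x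
  map-id⇒fixes (a ∷ L) e (here refl) = proj₁ (∷-inj e)
    where ∷-inj : ∀ {A : Set} {x y : A} {xs ys} → x ∷ xs ≡ y ∷ ys → x ≡ y × xs ≡ ys
          ∷-inj refl = refl , refl
  map-id⇒fixes (a ∷ L) e (there m) = map-id⇒fixes L (proj₂ (∷-inj e)) m
    where ∷-inj : ∀ {A : Set} {x y : A} {xs ys} → x ∷ xs ≡ y ∷ ys → x ≡ y × xs ≡ ys
          ∷-inj refl = refl , refl

  std-map : ∀ {h} v → PreservesOrder h v → std (map h v) ≡ std v
  std-map {h} v op = begin
      map (rank (map h v)) (map h v)   ≡⟨ sym (map-∘ v) ⟩
      map (λ a → rank (map h v) (h a)) v ≡⟨ map-cong-∈ v (λ {a} ma → cong suc (trans (countB-map h v) (countB-cong v (λ mc → op mc ma)))) ⟩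
      map (rank v) v ∎

  std-idem : ∀ v → std (std v) ≡ std v
  std-idem v = std-map v (rank-preservesOrder v)

  std-map-⊆ : ∀ {h} v u → PreservesOrder h v → u ⊆ v → std (map h u) ≡ std u
  std-map-⊆ {h} v u op s = std-map u (PreservesOrder-⊆ h op s)

  std-take-std : ∀ k v → std (take k (std v)) ≡ std (take k v)
  std-take-std k v = trans (cong std (take-map k v)) (std-map-⊆ v (take k v) (rank-preservesOrder v) (take-⊆ k v))

  std-drop-std : ∀ k v → std (drop k (std v)) ≡ std (drop k v)
  std-drop-std k v = trans (cong std (drop-map k v)) (std-map-⊆ v (drop k v) (rank-preservesOrder v) (drop-⊆ k v))

  length-std : ∀ v → length (std v) ≡ length v
  length-std v = length-map (rank v) v

  AllLess : List ℕ → List ℕ → Set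
  AllLess a b = ∀ {x y} → x ∈ a → y ∈ b → x < y

  allLess⇒AllLess : ∀ a b → allLess a b ≡ true → AllLess a b
  allLess⇒AllLess a b h mx my = <ᵇ-true⇒< (allB-∈ (allB-∈ h mx) my)

  AllLess⇒allLess : ∀ a b → AllLess a b → allLess a b ≡ true
  AllLess⇒allLess a b h = allB-intro a (λ mx → allB-intro b (λ my → <⇒<ᵇ-true (h mx my)))

  AllLess-⊆ : ∀ {a b a' b'} → AllLess a b → a' ⊆ a → b' ⊆ b → AllLess a' b'
  AllLess-⊆ h s1 s2 mx my = h (s1 mx) (s2 my)

  allLess-map : ∀ {h} v a b → PreservesOrder h v → a ⊆ v → b ⊆ v → allLess (map h a) (map h b) ≡ allLess a b
  allLess-map {h} v a b op sa sb =
    trans (allB-map h a) (allB-cong a (λ mx → trans (allB-map h b) (allB-cong b (λ my → op (sa mx) (sb my)))))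

  -- Permutations as words; direct and skew sums

  Distinct : List ℕ → Set
  Distinct [] = ⊤
  Distinct (a ∷ w) = a ∉ w × Distinct w

  Distinct-take : ∀ k w → Distinct w → Distinct (take k w)
  Distinct-take zero w d = tt
  Distinct-take (suc k) [] d = tt
  Distinct-take (suc k) (a ∷ w) (n , d) = (λ m → n (take-⊆ k w m)) , Distinct-take k w d

  Distinct-drop : ∀ k w → Distinct w → Distinct (drop k w)
  Distinct-drop zero w d = d
  Distinct-drop (suc k) [] d = tt
  Distinct-drop (suc k) (a ∷ w) (n , d) = Distinct-drop k w d

  Distinct-++ : ∀ a b → Distinct a → Distinct b → (∀ {x} → x ∈ a → x ∉ b) → Distinct (a ++ b)
  Distinct-++ [] b da db h = db
  Distinct-++ (x ∷ a) b (n , da) db h = nm , Distinct-++ a b da db (λ m → h (there m))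
    where nm : x ∉ a ++ b
          nm m with ∈-++⁻ a m
          ... | inj₁ m1 = n m1
          ... | inj₂ m2 = h (here refl) m2

  Distinct-map : ∀ {h : ℕ → ℕ} w → (∀ {a b} → a ∈ w → b ∈ w → h a ≡ h b → a ≡ b) → Distinct w → Distinct (map h w)
  Distinct-map [] inj d = tt
  Distinct-map {h} (a ∷ w) inj (n , d) = nm , Distinct-map w (λ ma mb → inj (there ma) (there mb)) d
    where nm : h a ∉ map h w
          nm m with ∈-map⁻ h m
          ... | b , mb , e with inj (here refl) (there mb) e
          ... | refl = n mb

  PreservesOrder⇒injective : ∀ {h v} → PreservesOrder h v → ∀ {a b} → a ∈ v → b ∈ v → h a ≡ h b → a ≡ b
  PreservesOrder⇒injective {h} op {a} {b} ma mb e with <-cmp a b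
  ... | tri≈ _ eq _ = eq
  ... | tri< lt _ _ = ⊥-elim (true≢false (trans (sym (trans (op ma mb) (<⇒<ᵇ-true lt))) (trans (cong (λ z → z <ᵇ h b) e) (n<ᵇn≡false (h b)))))
  ... | tri> _ _ gt = ⊥-elim (true≢false (trans (sym (trans (op mb ma) (<⇒<ᵇ-true gt))) (trans (cong (λ z → z <ᵇ h a) (sym e)) (n<ᵇn≡false (h a)))))

  IsPerm : ℕ → List ℕ → Set
  IsPerm n w = length w ≡ n × Distinct w × std w ≡ w

  rank-++ : ∀ a b x → rank (a ++ b) x ≡ suc (countB (λ c → c <ᵇ x) a + countB (λ c → c <ᵇ x) b)
  rank-++ a b x = cong suc (countB-++ a b)

  IsPerm-range : ∀ {n w} → IsPerm n w → ∀ {x} → x ∈ w → 1 ≤ x × x ≤ n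
  IsPerm-range {n} {w} (len , d , s) {x} m =
    subst (1 ≤_) fx (s≤s z≤n) ,
    subst (_≤ n) fx (subst (suc (countB (λ b → b <ᵇ x) w) ≤_) len (countB<length w m (n<ᵇn≡false x)))
    where fx : rank w x ≡ x
          fx = map-id⇒fixes w s m

  Distinct-std : ∀ v → Distinct v → Distinct (std v)
  Distinct-std v d = Distinct-map v (PreservesOrder⇒injective (rank-preservesOrder v)) d

  IsPerm-std : ∀ v → Distinct v → IsPerm (length v) (std v)
  IsPerm-std v d = length-std v , Distinct-std v d , std-idem v

  length-take≤ : ∀ {A : Set} i (w : List A) → i ≤ length w → length (take i w) ≡ i
  length-take≤ i w le = trans (length-take i w) (m≤n⇒m⊓n≡m le)

  take-++-len : ∀ {A : Set} (a b : List A) → take (length a) (a ++ b) ≡ a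
  take-++-len [] b = refl
  take-++-len (x ∷ a) b = cong (x ∷_) (take-++-len a b)

  drop-++-len : ∀ {A : Set} (a b : List A) → drop (length a) (a ++ b) ≡ b
  drop-++-len [] b = refl
  drop-++-len (x ∷ a) b = drop-++-len a b

  module Split {n w i} (p : IsPerm n w) (le : i ≤ n) where
    front = take i w
    back = drop i w
    front++back : front ++ back ≡ w
    front++back = take++drop≡id i w
    rank-front-back : ∀ x → rank w x ≡ suc (countB (λ c → c <ᵇ x) front + countB (λ c → c <ᵇ x) back)
    rank-front-back x = trans (cong (λ z → rank z x) (sym front++back)) (rank-++ front back x)
    rank-fixes : ∀ {x} → x ∈ w → rank w x ≡ x
    rank-fixes m = map-id⇒fixes w (proj₂ (proj₂ p)) m
    length-front : length front ≡ i
    length-front = length-take≤ i w (subst (i ≤_) (sym (proj₁ p)) le)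
    length-back : length back ≡ n ∸ i
    length-back = trans (length-drop i w) (cong (_∸ i) (proj₁ p))
    Distinct-front : Distinct front
    Distinct-front = Distinct-take i w (proj₁ (proj₂ p))
    Distinct-back : Distinct back
    Distinct-back = Distinct-drop i w (proj₁ (proj₂ p))

    module Plus (al : AllLess front back) where
      stdT : std front ≡ front
      stdT = map-id-∈ front λ {x} m →
        let cT = countB (λ c → c <ᵇ x) front in
        begin
          suc cT ≡⟨ cong suc (sym (+-identityʳ _)) ⟩
          suc (cT + 0) ≡⟨ cong (λ z → suc (cT + z)) (sym (countB-zero back (λ my → ≮⇒<ᵇ-false (<⇒≯ (al m my))))) ⟩
          suc (cT + countB (λ c → c <ᵇ x) back) ≡⟨ sym (rank-front-back x) ⟩
          rank w x ≡⟨ rank-fixes (take-⊆ i w m) ⟩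
          x ∎
      stdD : map (_+ i) (std back) ≡ back
      stdD = trans (sym (map-∘ back)) (map-id-∈ back λ {y} m →
        let cD = countB (λ c → c <ᵇ y) back in
        begin
          suc cD + i ≡⟨ cong suc (+-comm cD i) ⟩
          suc (i + cD) ≡⟨ cong (λ z → suc (z + cD)) (sym (trans (countB-all front (λ mx → <⇒<ᵇ-true (al mx m))) length-front)) ⟩
          suc (countB (λ c → c <ᵇ y) front + cD) ≡⟨ sym (rank-front-back y) ⟩
          rank w y ≡⟨ rank-fixes (drop-⊆ i w m) ⟩
          y ∎)
      reassemble : std front ++ map (_+ i) (std back) ≡ w
      reassemble = trans (cong₂ _++_ stdT stdD) front++back
      front-isPerm : IsPerm i (std front)
      front-isPerm = subst (λ z → IsPerm z (std front)) length-front (IsPerm-std front Distinct-front)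
      back-isPerm : IsPerm (n ∸ i) (std back)
      back-isPerm = subst (λ z → IsPerm z (std back)) length-back (IsPerm-std back Distinct-back)

    module Minus (al : AllLess back front) where
      stdT : map (_+ (n ∸ i)) (std front) ≡ front
      stdT = trans (sym (map-∘ front)) (map-id-∈ front λ {x} m →
        let cT = countB (λ c → c <ᵇ x) front in
        begin
          suc cT + (n ∸ i) ≡⟨ cong (λ z → suc (cT + z)) (sym (trans (countB-all back (λ my → <⇒<ᵇ-true (al my m))) length-back)) ⟩
          suc (cT + countB (λ c → c <ᵇ x) back) ≡⟨ sym (rank-front-back x) ⟩
          rank w x ≡⟨ rank-fixes (take-⊆ i w m) ⟩
          x ∎)
      stdD : std back ≡ back
      stdD = map-id-∈ back λ {y} m →
        let cD = countB (λ c → c <ᵇ y) back in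
        begin
          suc cD ≡⟨ cong (λ z → suc (z + cD)) (sym (countB-zero front (λ mx → ≮⇒<ᵇ-false (<⇒≯ (al m mx))))) ⟩
          suc (countB (λ c → c <ᵇ y) front + cD) ≡⟨ sym (rank-front-back y) ⟩
          rank w y ≡⟨ rank-fixes (drop-⊆ i w m) ⟩
          y ∎
      reassemble : map (_+ (n ∸ i)) (std front) ++ std back ≡ w
      reassemble = trans (cong₂ _++_ stdT stdD) front++back
      front-isPerm : IsPerm i (std front)
      front-isPerm = subst (λ z → IsPerm z (std front)) length-front (IsPerm-std front Distinct-front)
      back-isPerm : IsPerm (n ∸ i) (std back)
      back-isPerm = subst (λ z → IsPerm z (std back)) length-back (IsPerm-std back Distinct-back)

  module Build {i j α β} (pa : IsPerm i α) (pb : IsPerm j β) where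
    lenα : length α ≡ i
    lenα = proj₁ pa
    rα : ∀ {x} → x ∈ α → 1 ≤ x × x ≤ i
    rα = IsPerm-range pa
    rβ : ∀ {x} → x ∈ β → 1 ≤ x × x ≤ j
    rβ = IsPerm-range pb
    injP : ∀ c {a b : ℕ} → a ∈ β → b ∈ β → a + c ≡ b + c → a ≡ b
    injP c _ _ e = +-cancelʳ-≡ _ _ _ e
    injA : ∀ c {a b : ℕ} → a ∈ α → b ∈ α → a + c ≡ b + c → a ≡ b
    injA c _ _ e = +-cancelʳ-≡ _ _ _ e

    module Plus where
      β' = map (_+ i) β
      π = α ++ β'
      takeπ : take i π ≡ α
      takeπ = subst (λ z → take z π ≡ α) lenα (take-++-len α β')
      dropπ : drop i π ≡ β'
      dropπ = subst (λ z → drop z π ≡ β') lenα (drop-++-len α β')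
      al : AllLess α β'
      al {x} {y} mx my with ∈-map⁻ (_+ i) my
      ... | b , mb , refl = ≤-<-trans (proj₂ (rα mx)) (+-monoˡ-≤ i (proj₁ (rβ mb)))
      stdT : std (take i π) ≡ α
      stdT = trans (cong std takeπ) (proj₂ (proj₂ pa))
      stdD : std (drop i π) ≡ β
      stdD = trans (cong std dropπ) (trans (std-map β (+-preservesOrder i β)) (proj₂ (proj₂ pb)))
      sum-isPerm : IsPerm (i + j) π
      sum-isPerm = len , dist , sd
        where
        len : length π ≡ i + j
        len = trans (length-++ α) (cong₂ _+_ lenα (trans (length-map _ β) (proj₁ pb)))
        dist : Distinct π
        dist = Distinct-++ α β' (proj₁ (proj₂ pa)) (Distinct-map β (injP i) (proj₁ (proj₂ pb)))
                 (λ mx my → <⇒≢ (al mx my) refl)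
        sd : std π ≡ π
        sd = trans (map-++ (rank π) α β') (cong₂ _++_
          (map-id-∈ α λ {x} mx → trans (rank-++ α β' x)
            (trans (cong (λ z → suc (countB (λ c → c <ᵇ x) α + z)) (countB-zero β' (λ my → ≮⇒<ᵇ-false (<⇒≯ (al mx my)))))
            (trans (cong suc (+-identityʳ _)) (map-id⇒fixes α (proj₂ (proj₂ pa)) mx))))
          (trans (sym (map-∘ β)) (map-cong-∈ β λ {y} my →
            begin
              rank π (y + i) ≡⟨ rank-++ α β' (y + i) ⟩
              suc (countB (λ c → c <ᵇ (y + i)) α + countB (λ c → c <ᵇ (y + i)) β')
                ≡⟨ cong₂ (λ a b → suc (a + b))
                     (trans (countB-all α (λ mx → <⇒<ᵇ-true (al mx (∈-map⁺ (_+ i) my)))) lenα)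
                     (trans (countB-map (_+ i) β) (countB-cong β (λ mc → +-preservesOrder i β mc my))) ⟩
              suc (i + countB (λ c → c <ᵇ y) β) ≡⟨ cong suc (+-comm i _) ⟩
              rank β y + i ≡⟨ cong (_+ i) (map-id⇒fixes β (proj₂ (proj₂ pb)) my) ⟩
              y + i ∎)))

    module Minus where
      α' = map (_+ j) α
      π = α' ++ β
      lenα' : length α' ≡ i
      lenα' = trans (length-map _ α) lenα
      takeπ : take i π ≡ α'
      takeπ = subst (λ z → take z π ≡ α') lenα' (take-++-len α' β)
      dropπ : drop i π ≡ β
      dropπ = subst (λ z → drop z π ≡ β) lenα' (drop-++-len α' β)
      al : AllLess β α'
      al {y} {x} my mx with ∈-map⁻ (_+ j) mx
      ... | a , ma , refl = ≤-<-trans (proj₂ (rβ my)) (+-monoˡ-≤ j (proj₁ (rα ma)))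
      stdT : std (take i π) ≡ α
      stdT = trans (cong std takeπ) (trans (std-map α (+-preservesOrder j α)) (proj₂ (proj₂ pa)))
      stdD : std (drop i π) ≡ β
      stdD = trans (cong std dropπ) (proj₂ (proj₂ pb))
      sum-isPerm : IsPerm (i + j) π
      sum-isPerm = len , dist , sd
        where
        len : length π ≡ i + j
        len = trans (length-++ α') (cong₂ _+_ lenα' (proj₁ pb))
        dist : Distinct π
        dist = Distinct-++ α' β (Distinct-map α (injA j) (proj₁ (proj₂ pa))) (proj₁ (proj₂ pb))
                 (λ mx my → <⇒≢ (al my mx) refl)
          where open import Function using (_∘′_)
        sd : std π ≡ π
        sd = trans (map-++ (rank π) α' β) (cong₂ _++_
          (trans (sym (map-∘ α)) (map-cong-∈ α λ {x} mx →
            begin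
              rank π (x + j) ≡⟨ rank-++ α' β (x + j) ⟩
              suc (countB (λ c → c <ᵇ (x + j)) α' + countB (λ c → c <ᵇ (x + j)) β)
                ≡⟨ cong₂ (λ a b → suc (a + b))
                     (trans (countB-map (_+ j) α) (countB-cong α (λ mc → +-preservesOrder j α mc mx)))
                     (trans (countB-all β (λ my → <⇒<ᵇ-true (al my (∈-map⁺ (_+ j) mx)))) (proj₁ pb)) ⟩
              suc (countB (λ c → c <ᵇ x) α + j) ≡⟨⟩
              rank α x + j ≡⟨ cong (_+ j) (map-id⇒fixes α (proj₂ (proj₂ pa)) mx) ⟩
              x + j ∎))
          (map-id-∈ β λ {y} my → trans (rank-++ α' β y)
            (trans (cong (λ z → suc (z + countB (λ c → c <ᵇ y) β)) (countB-zero α' (λ mx → ≮⇒<ᵇ-false (<⇒≯ (al my mx)))))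
            (map-id⇒fixes β (proj₂ (proj₂ pb)) my))))

  take-take-⊆ : ∀ a b (w : List ℕ) → take a (take b w) ⊆ take a w
  take-take-⊆ zero b w ()
  take-take-⊆ (suc a) zero w ()
  take-take-⊆ (suc a) (suc b) [] ()
  take-take-⊆ (suc a) (suc b) (x ∷ w) (here p) = here p
  take-take-⊆ (suc a) (suc b) (x ∷ w) (there m) = there (take-take-⊆ a b w m)

  drop-take-⊆ : ∀ a b (w : List ℕ) → drop a (take b w) ⊆ drop a w
  drop-take-⊆ zero b w m = take-⊆ b w m
  drop-take-⊆ (suc a) zero w ()
  drop-take-⊆ (suc a) (suc b) [] ()
  drop-take-⊆ (suc a) (suc b) (x ∷ w) m = drop-take-⊆ a b w m

  take-take≤ : ∀ a b (w : List ℕ) → a ≤ b → take a (take b w) ≡ take a w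
  take-take≤ zero b w _ = refl
  take-take≤ (suc a) (suc b) [] _ = refl
  take-take≤ (suc a) (suc b) (x ∷ w) (s≤s le) = cong (x ∷_) (take-take≤ a b w le)

  take-+ : ∀ k j (w : List ℕ) → take (k + j) w ≡ take k w ++ take j (drop k w)
  take-+ zero j w = refl
  take-+ (suc k) j [] = sym (cong ([] ++_) (take-[] j))
  take-+ (suc k) j (x ∷ w) = cong (x ∷_) (take-+ k j w)

  drop-take-++ : ∀ j k (w : List ℕ) → j ≤ k → drop j w ≡ drop j (take k w) ++ drop k w
  drop-take-++ zero zero w _ = refl
  drop-take-++ zero (suc k) [] _ = refl
  drop-take-++ zero (suc k) (x ∷ w) _ = cong (x ∷_) (drop-take-++ zero k w z≤n)
  drop-take-++ (suc j) (suc k) [] _ = refl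
  drop-take-++ (suc j) (suc k) (x ∷ w) (s≤s le) = drop-take-++ j k w le

  drop-nonempty : ∀ k (w : List ℕ) → k < length w → Σ ℕ λ y → y ∈ drop k w
  drop-nonempty zero (x ∷ w) _ = x , here refl
  drop-nonempty (suc k) (x ∷ w) (s≤s lt) = drop-nonempty k w lt

  drop-antitone : ∀ j k (w : List ℕ) → j ≤ k → drop k w ⊆ drop j w
  drop-antitone zero k w _ m = drop-⊆ k w m
  drop-antitone (suc j) (suc k) [] _ ()
  drop-antitone (suc j) (suc k) (x ∷ w) (s≤s le) m = drop-antitone j k w le m

  length-std-take : ∀ k w → k ≤ length w → length (std (take k w)) ≡ k
  length-std-take k w le = trans (length-std (take k w)) (length-take≤ k w le)

  length-std-drop : ∀ k w → length (std (drop k w)) ≡ length w ∸ k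
  length-std-drop k w = trans (length-std (drop k w)) (length-drop k w)

  isOne : List ℕ → Bool
  isOne (suc zero ∷ []) = true
  isOne _ = false

  isOne⇒≡1 : ∀ π → isOne π ≡ true → π ≡ suc zero ∷ []
  isOne⇒≡1 [] ()
  isOne⇒≡1 (zero ∷ _) ()
  isOne⇒≡1 (suc zero ∷ []) _ = refl
  isOne⇒≡1 (suc zero ∷ _ ∷ _) ()
  isOne⇒≡1 (suc (suc _) ∷ _) ()

  isOne-length≥2 : ∀ π → 2 ≤ length π → isOne π ≡ false
  isOne-length≥2 (zero ∷ _) _ = refl
  isOne-length≥2 (suc zero ∷ _ ∷ _) _ = refl
  isOne-length≥2 (suc (suc _) ∷ _) _ = refl
  isOne-length≥2 (suc zero ∷ []) (s≤s ())

  splitWith : (List ℕ → Bool) → List ℕ → ℕ → Bool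
  splitWith S π k =
    not (k ≡ᵇ 0) ∧ (not (length (drop k π) ≡ᵇ 0) ∧
        ((allLess (take k π) (drop k π) ∨ allLess (drop k π) (take k π)) ∧ (S (std (take k π)) ∧ S (std (drop k π)))))

  isSepSplit : List ℕ → ℕ → Bool
  isSepSplit = splitWith isSep

  splitWith-cong : ∀ S S' π k → k < length π → (∀ ρ → length ρ < length π → S ρ ≡ S' ρ) → splitWith S π k ≡ splitWith S' π k
  splitWith-cong S S' π zero lt h = refl
  splitWith-cong S S' (x ∷ π) (suc k) (s≤s lt) h =
    cong (λ z → not (length (drop k π) ≡ᵇ 0) ∧ ((allLess (take (suc k) (x ∷ π)) (drop k π) ∨ allLess (drop k π) (take (suc k) (x ∷ π))) ∧ z))
      (cong₂ _∧_ (h _ l1) (h _ l2))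
    where
    l1 : length (std (take (suc k) (x ∷ π))) < suc (length π)
    l1 = subst (_< suc (length π)) (sym (length-std-take (suc k) (x ∷ π) (≤-trans (n≤1+n (suc k)) (s≤s lt)))) (s≤s lt)
    l2 : length (std (drop k π)) < suc (length π)
    l2 = s≤s (subst (_≤ length π) (sym (length-std-drop k π)) (m∸n≤m (length π) k))

  sepF-splits-fuel : ∀ f g π → length π ≤ suc f → length π ≤ suc g → (∀ ρ → length ρ ≤ f → length ρ ≤ g → sepF f ρ ≡ sepF g ρ) →
    anyB (splitWith (sepF f) π) (upTo (length π)) ≡ anyB (splitWith (sepF g) π) (upTo (length π))
  sepF-splits-fuel f g π lf lg ih = anyB-cong (upTo (length π)) λ {k} mk →
      splitWith-cong (sepF f) (sepF g) π k (∈-upTo⁻ mk)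
        (λ ρ lt → ih ρ (≤-pred (≤-trans lt lf)) (≤-pred (≤-trans lt lg)))

  sepF-fuel : ∀ f g π → length π ≤ f → length π ≤ g → sepF f π ≡ sepF g π
  sepF-fuel zero zero π _ _ = refl
  sepF-fuel zero (suc g) [] _ _ = refl
  sepF-fuel (suc f) zero [] _ _ = refl
  sepF-fuel (suc f) (suc g) [] _ _ = refl
  sepF-fuel (suc f) (suc g) π@(zero ∷ _) lf lg = sepF-splits-fuel f g π lf lg (sepF-fuel f g)
  sepF-fuel (suc f) (suc g) π@(suc zero ∷ []) lf lg = cong (true ∨_) (sepF-splits-fuel f g π lf lg (sepF-fuel f g))
  sepF-fuel (suc f) (suc g) π@(suc zero ∷ _ ∷ _) lf lg = sepF-splits-fuel f g π lf lg (sepF-fuel f g)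
  sepF-fuel (suc f) (suc g) π@(suc (suc _) ∷ _) lf lg = sepF-splits-fuel f g π lf lg (sepF-fuel f g)

  isSep-splits-unfold : ∀ π (m : ℕ) → length π ≡ suc m → anyB (splitWith (sepF m) π) (upTo (suc m)) ≡ anyB (isSepSplit π) (upTo (suc m))
  isSep-splits-unfold π m e = anyB-cong (upTo (suc m)) λ {k} mk →
    splitWith-cong (sepF m) isSep π k (subst (k <_) (sym e) (∈-upTo⁻ mk))
      (λ ρ lt → sepF-fuel m (length ρ) ρ (≤-pred (subst (length ρ <_) e lt)) ≤-refl)

  isSep-unfold : ∀ x π → isSep (x ∷ π) ≡ isOne (x ∷ π) ∨ anyB (isSepSplit (x ∷ π)) (upTo (suc (length π)))
  isSep-unfold zero π = isSep-splits-unfold (zero ∷ π) (length π) refl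
  isSep-unfold (suc zero) [] = cong (true ∨_) (isSep-splits-unfold (suc zero ∷ []) 0 refl)
  isSep-unfold (suc zero) (y ∷ π) = isSep-splits-unfold (suc zero ∷ y ∷ π) (length (y ∷ π)) refl
  isSep-unfold (suc (suc x)) π = isSep-splits-unfold (suc (suc x) ∷ π) (length π) refl

  isSep⇒one⊎split : ∀ π → isSep π ≡ true → (π ≡ suc zero ∷ []) ⊎ Σ ℕ (λ k → k < length π × isSepSplit π k ≡ true)
  isSep⇒one⊎split [] ()
  isSep⇒one⊎split (x ∷ π) h with ∨-true⁻ (trans (sym (isSep-unfold x π)) h)
  ... | inj₁ e = inj₁ (isOne⇒≡1 _ e)
  ... | inj₂ e with anyB-elim _ e
  ... | k , mk , s = inj₂ (k , ∈-upTo⁻ mk , s)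

  isSepSplit⇒isSep : ∀ π k → k < length π → isSepSplit π k ≡ true → isSep π ≡ true
  isSepSplit⇒isSep (x ∷ π) k lt h = trans (isSep-unfold x π) (∨-true⁺ʳ (anyB-intro {P = isSepSplit (x ∷ π)} (∈-upTo⁺ lt) h))

  isSepSplit⁻ : ∀ π k → isSepSplit π k ≡ true → 0 < k × (allLess (take k π) (drop k π) ∨ allLess (drop k π) (take k π)) ≡ true
    × isSep (std (take k π)) ≡ true × isSep (std (drop k π)) ≡ true
  isSepSplit⁻ π zero ()
  isSepSplit⁻ π (suc k) h =
    let (_ , h2) = ∧-true⁻ {not (length (drop (suc k) π) ≡ᵇ 0)} h ; (c , h3) = ∧-true⁻ h2 ; (s1 , s2) = ∧-true⁻ h3 in s≤s z≤n , c , s1 , s2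

  isSepSplit⁺ : ∀ π k → 0 < k → k < length π → (allLess (take k π) (drop k π) ∨ allLess (drop k π) (take k π)) ≡ true
    → isSep (std (take k π)) ≡ true → isSep (std (drop k π)) ≡ true → isSepSplit π k ≡ true
  isSepSplit⁺ π (suc k) _ lt c s1 s2 rewrite ≢⇒≡ᵇ-false {length (drop (suc k) π)} {0} (λ e → <⇒≢ (m<n⇒0<n∸m lt) (sym (trans (sym (length-drop (suc k) π)) e))) | c | s1 | s2 = refl

  -- splitsAs true: a ++ b is a direct sum (a below b); splitsAs false: a skew sum.
  splitsAs : Bool → List ℕ → List ℕ → Bool
  splitsAs true a b = allLess a b
  splitsAs false a b = allLess b a

  splitsAs-⊆ : ∀ d {a b a' b'} → splitsAs d a b ≡ true → a' ⊆ a → b' ⊆ b → splitsAs d a' b' ≡ true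
  splitsAs-⊆ true {a} {b} {a'} {b'} h s1 s2 = AllLess⇒allLess a' b' (AllLess-⊆ (allLess⇒AllLess a b h) s1 s2)
  splitsAs-⊆ false {a} {b} {a'} {b'} h s1 s2 = AllLess⇒allLess b' a' (AllLess-⊆ (allLess⇒AllLess b a h) s2 s1)

  splitsAs-map : ∀ d {h} v a b → PreservesOrder h v → a ⊆ v → b ⊆ v → splitsAs d (map h a) (map h b) ≡ splitsAs d a b
  splitsAs-map true v a b op sa sb = allLess-map v a b op sa sb
  splitsAs-map false v a b op sa sb = allLess-map v b a op sb sa

  splitsAs-std : ∀ d k v → splitsAs d (take k (std v)) (drop k (std v)) ≡ splitsAs d (take k v) (drop k v)
  splitsAs-std d k v = trans (cong₂ (splitsAs d) (take-map k v) (drop-map k v))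
    (splitsAs-map d v (take k v) (drop k v) (rank-preservesOrder v) (take-⊆ k v) (drop-⊆ k v))

  splitsAs⇒allLess∨ : ∀ d {a b} → splitsAs d a b ≡ true → (allLess a b ∨ allLess b a) ≡ true
  splitsAs⇒allLess∨ true h = ∨-true⁺ˡ h
  splitsAs⇒allLess∨ false h = ∨-true⁺ʳ h

  allLess∨⇒splitsAs : ∀ d {a b} → (allLess a b ∨ allLess b a) ≡ true → splitsAs d a b ≡ true ⊎ splitsAs (not d) a b ≡ true
  allLess∨⇒splitsAs true h = ∨-true⁻ h
  allLess∨⇒splitsAs false h with ∨-true⁻ h
  ... | inj₁ e = inj₂ e
  ... | inj₂ e = inj₁ e

  splitsAs-exclusive : ∀ d π k k' → 0 < k → k < length π → 0 < k' → k' < length π →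
    splitsAs d (take k π) (drop k π) ≡ true → splitsAs (not d) (take k' π) (drop k' π) ≡ true → ⊥
  splitsAs-exclusive d (x ∷ π) (suc k) (suc k') _ lt _ lt' h h' with drop-nonempty (suc k ⊔ suc k') (x ∷ π) (⊔-lub lt lt')
  ... | y , my = go d h h'
    where
    my1 : y ∈ drop (suc k) (x ∷ π)
    my1 = drop-antitone (suc k) _ (x ∷ π) (m≤m⊔n (suc k) (suc k')) my
    my2 : y ∈ drop (suc k') (x ∷ π)
    my2 = drop-antitone (suc k') _ (x ∷ π) (m≤n⊔m (suc k) (suc k')) my
    go : ∀ d → splitsAs d (take (suc k) (x ∷ π)) (drop (suc k) (x ∷ π)) ≡ true → splitsAs (not d) (take (suc k') (x ∷ π)) (drop (suc k') (x ∷ π)) ≡ true → ⊥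
    T1 = take (suc k) (x ∷ π)
    D1 = drop (suc k) (x ∷ π)
    T2 = take (suc k') (x ∷ π)
    D2 = drop (suc k') (x ∷ π)
    go true e e' = <-asym (allLess⇒AllLess T1 D1 e (here refl) my1) (allLess⇒AllLess D2 T2 e' my2 (here refl))
    go false e e' = <-asym (allLess⇒AllLess D1 T1 e my1 (here refl)) (allLess⇒AllLess T2 D2 e' (here refl) my2)

  Separable : List ℕ → Set
  Separable ρ = isSep ρ ≡ true

  SeparableParts : List ℕ → ℕ → Set
  SeparableParts π k = Separable (std (take k π)) × Separable (std (drop k π))

  PartsHypothesis : Bool → List ℕ → Set
  PartsHypothesis d π = ∀ π' j → length π' < length π → Separable π' → 0 < j → j < length π' →
    splitsAs d (take j π') (drop j π') ≡ true → SeparableParts π' j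

  Separable-≡ : ∀ {a b} → a ≡ b → Separable a → Separable b
  Separable-≡ e = subst Separable e

  take-drop-⊆ : ∀ k e (π : List ℕ) → take e (drop k π) ⊆ take (k + e) π
  take-drop-⊆ k e π m = subst (_ ∈_) (sym (take-+ k e π)) (∈-++⁺ʳ (take k π) m)

  drop-drop-⊆ : ∀ k e (π : List ℕ) → drop e (drop k π) ⊆ drop (k + e) π
  drop-drop-⊆ k e π m = subst (_ ∈_) (drop-drop k e π) m

  +<⇒<∸ : ∀ k e n → k + e < n → e < n ∸ k
  +<⇒<∸ k e n lt = subst (_< n ∸ k) (m+n∸m≡n k e) (∸-monoˡ-< lt (m≤m+n k e))

  parts-widen : ∀ d π k0 e → PartsHypothesis d π → 0 < k0 → 0 < e → k0 + e < length π →
    splitsAs d (take (k0 + e) π) (drop (k0 + e) π) ≡ true → splitsAs d (take k0 π) (drop k0 π) ≡ true →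
    SeparableParts π k0 → SeparableParts π (k0 + e)
  parts-widen d π k0 e IH k0>0 e>0 lt c same (sT0 , sD0) = sepTk , b'
    where
    D0 = drop k0 π
    π' = std D0
    Tk = take (k0 + e) π
    lenπ' : length π' ≡ length π ∸ k0
    lenπ' = length-std-drop k0 π
    ltπ' : length π' < length π
    ltπ' = subst (_< length π) (sym lenπ') (∸-monoʳ-< k0>0 (≤-trans (m≤m+n k0 e) (<⇒≤ lt)))
    cπ' : splitsAs d (take e π') (drop e π') ≡ true
    cπ' = trans (splitsAs-std d e D0) (splitsAs-⊆ d c (take-drop-⊆ k0 e π) (drop-drop-⊆ k0 e π))
    ih = IH π' e ltπ' sD0 e>0 (subst (e <_) (sym lenπ') (+<⇒<∸ k0 e (length π) lt)) cπ'
    b' : Separable (std (drop (k0 + e) π))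
    b' = Separable-≡ (trans (std-drop-std e D0) (cong std (drop-drop k0 e π))) (proj₂ ih)
    ρ = std Tk
    lenρ : length ρ ≡ k0 + e
    lenρ = length-std-take (k0 + e) π (<⇒≤ lt)
    cρ : splitsAs d (take k0 ρ) (drop k0 ρ) ≡ true
    cρ = trans (splitsAs-std d k0 Tk) (splitsAs-⊆ d same (take-take-⊆ k0 (k0 + e) π) (drop-take-⊆ k0 (k0 + e) π))
    sA : Separable (std (take k0 ρ))
    sA = Separable-≡ (sym (trans (std-take-std k0 Tk) (cong std (take-take≤ k0 (k0 + e) π (m≤m+n k0 e))))) sT0
    sB : Separable (std (drop k0 ρ))
    sB = Separable-≡ (trans (std-take-std e D0) (trans (cong std (take-drop e k0 π)) (sym (std-drop-std k0 Tk)))) (proj₁ ih)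
    ltρ : k0 < length ρ
    ltρ = subst (k0 <_) (sym lenρ) (m<m+n k0 e>0)
    sepTk : Separable (std Tk)
    sepTk = isSepSplit⇒isSep ρ k0 ltρ (isSepSplit⁺ ρ k0 k0>0 ltρ (splitsAs⇒allLess∨ d cρ) sA sB)

  parts-narrow : ∀ d π k e → PartsHypothesis d π → 0 < k → 0 < e → k + e < length π →
    splitsAs d (take k π) (drop k π) ≡ true → splitsAs d (take (k + e) π) (drop (k + e) π) ≡ true →
    SeparableParts π (k + e) → SeparableParts π k
  parts-narrow d π k e IH k>0 e>0 lt c same (sT0 , sD0) = a' , sepDk
    where
    Tk0 = take (k + e) π
    π'' = std Tk0
    lenπ'' : length π'' ≡ k + e
    lenπ'' = length-std-take (k + e) π (<⇒≤ lt)
    cπ'' : splitsAs d (take k π'') (drop k π'') ≡ true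
    cπ'' = trans (splitsAs-std d k Tk0) (splitsAs-⊆ d c (take-take-⊆ k (k + e) π) (drop-take-⊆ k (k + e) π))
    ih = IH π'' k (subst (_< length π) (sym lenπ'') lt) sT0 k>0 (subst (k <_) (sym lenπ'') (m<m+n k e>0)) cπ''
    a' : Separable (std (take k π))
    a' = Separable-≡ (trans (std-take-std k Tk0) (cong std (take-take≤ k (k + e) π (m≤m+n k e)))) (proj₁ ih)
    Dk = drop k π
    σ = std Dk
    lenσ : length σ ≡ length π ∸ k
    lenσ = length-std-drop k π
    ltσ : e < length σ
    ltσ = subst (e <_) (sym lenσ) (+<⇒<∸ k e (length π) lt)
    cσ : splitsAs d (take e σ) (drop e σ) ≡ true
    cσ = trans (splitsAs-std d e Dk) (splitsAs-⊆ d same (take-drop-⊆ k e π) (drop-drop-⊆ k e π))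
    sA : Separable (std (take e σ))
    sA = Separable-≡ (trans (std-drop-std k Tk0) (sym (trans (std-take-std e Dk) (cong std (take-drop e k π))))) (proj₂ ih)
    sB : Separable (std (drop e σ))
    sB = Separable-≡ (sym (trans (std-drop-std e Dk) (cong std (drop-drop k e π)))) sD0
    sepDk : Separable σ
    sepDk = isSepSplit⇒isSep σ e ltσ (isSepSplit⁺ σ e e>0 ltσ (splitsAs⇒allLess∨ d cσ) sA sB)

  -- The cut k0 witnessing separability has the same type d as k (splitsAs-exclusive); the
  -- blocks between k0 and k are cuts of a strictly shorter separable part, so induction on
  -- the length regroups them.
  separableParts-bounded : ∀ d N π k → length π ≤ N → Separable π → 0 < k → k < length π → splitsAs d (take k π) (drop k π) ≡ true → SeparableParts π k
  separableParts-bounded d zero π k le s k>0 lt c = ⊥-elim (<⇒≱ (<-≤-trans lt le) z≤n)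
  separableParts-bounded d (suc N) π k le s k>0 lt c with isSep⇒one⊎split π s
  ... | inj₁ refl = ⊥-elim (<⇒≱ lt k>0)
  ... | inj₂ (k0 , lt0 , ok) with isSepSplit⁻ π k0 ok
  ... | (k0>0 , c0 , sT0 , sD0) with allLess∨⇒splitsAs d c0
  ... | inj₂ opp = ⊥-elim (splitsAs-exclusive d π k k0 k>0 lt k0>0 lt0 c opp)
  ... | inj₁ same with <-cmp k0 k
  ... | tri≈ _ refl _ = sT0 , sD0
  ... | tri< k0<k _ _ =
    subst (SeparableParts π) eqk (parts-widen d π k0 (k ∸ k0) IH k0>0 (m<n⇒0<n∸m k0<k)
            (subst (_< length π) (sym eqk) lt) (subst (λ z → splitsAs d (take z π) (drop z π) ≡ true) (sym eqk) c) same (sT0 , sD0))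
    where
    eqk : k0 + (k ∸ k0) ≡ k
    eqk = m+[n∸m]≡n (<⇒≤ k0<k)
    IH : PartsHypothesis d π
    IH π' j lt' = separableParts-bounded d N π' j (≤-pred (≤-trans lt' le))
  ... | tri> _ _ k<k0 =
    parts-narrow d π k (k0 ∸ k) IH k>0 (m<n⇒0<n∸m k<k0) (subst (_< length π) (sym eqk) lt0) c
      (subst (λ z → splitsAs d (take z π) (drop z π) ≡ true) (sym eqk) same) (subst (SeparableParts π) (sym eqk) (sT0 , sD0))
    where
    eqk : k + (k0 ∸ k) ≡ k0
    eqk = m+[n∸m]≡n (<⇒≤ k<k0)
    IH : PartsHypothesis d π
    IH π' j lt' = separableParts-bounded d N π' j (≤-pred (≤-trans lt' le))

  separableParts : ∀ d π k → Separable π → 0 < k → k < length π → splitsAs d (take k π) (drop k π) ≡ true → SeparableParts π k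
  separableParts d π k = separableParts-bounded d (length π) π k ≤-refl

  -- The canonical decomposition

  greatestWitness : ∀ (D : ℕ → Bool) N k → k < N → D k ≡ true →
    Σ ℕ λ m → m < N × D m ≡ true × (∀ j → m < j → j < N → D j ≡ false)
  greatestWitness D zero k () h
  greatestWitness D (suc N) k lt h with D N in e
  ... | true = N , ≤-refl , e , (λ j mj jN → ⊥-elim (<⇒≱ mj (≤-pred jN)))
  ... | false with m≤n⇒m<n∨m≡n (≤-pred lt)
  ... | inj₂ refl = ⊥-elim (true≢false (trans (sym h) e))
  ... | inj₁ k<N with greatestWitness D N k k<N h
  ... | m , mN , dm , mx = m , m≤n⇒m≤1+n mN , dm , go
    where
    go : ∀ j → m < j → j < suc N → D j ≡ false
    go j mj jN with m≤n⇒m<n∨m≡n (≤-pred jN)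
    ... | inj₁ j<N = mx j mj j<N
    ... | inj₂ refl = e

  leastWitness-or-none : ∀ (D : ℕ → Bool) N → (∀ j → j < N → D j ≡ false) ⊎ (Σ ℕ λ m → m < N × D m ≡ true × (∀ j → j < m → D j ≡ false))
  leastWitness-or-none D zero = inj₁ (λ j ())
  leastWitness-or-none D (suc N) with leastWitness-or-none D N
  ... | inj₂ (m , mN , dm , mn) = inj₂ (m , m≤n⇒m≤1+n mN , dm , mn)
  ... | inj₁ none with D N in e
  ... | true = inj₂ (N , ≤-refl , e , none)
  ... | false = inj₁ go
    where
    go : ∀ j → j < suc N → D j ≡ false
    go j jN with m≤n⇒m<n∨m≡n (≤-pred jN)
    ... | inj₁ j<N = none j j<N
    ... | inj₂ refl = e

  leastWitness : ∀ (D : ℕ → Bool) k → D k ≡ true → Σ ℕ λ m → m ≤ k × D m ≡ true × (∀ j → j < m → D j ≡ false)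
  leastWitness D k h with leastWitness-or-none D (suc k)
  ... | inj₁ none = ⊥-elim (true≢false (trans (sym h) (none k ≤-refl)))
  ... | inj₂ (m , mk , dm , mn) = m , ≤-pred mk , dm , mn

  reducibleAt : List ℕ → ℕ → Bool
  reducibleAt π k = not (k ≡ᵇ 0) ∧ allLess (take k π) (drop k π)

  reducible⇒split : ∀ π → isIrr π ≡ false → Σ ℕ λ k → 0 < k × k < length π × allLess (take k π) (drop k π) ≡ true
  reducible⇒split π h with anyB-elim {P = reducibleAt π} (upTo (length π)) (not-false⁻ h)
  ... | zero , mk , ()
  ... | suc k , mk , e = suc k , s≤s z≤n , ∈-upTo⁻ mk , e

  split⇒reducible : ∀ π k → 0 < k → k < length π → allLess (take k π) (drop k π) ≡ true → isIrr π ≡ false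
  split⇒reducible π (suc k) _ lt e = cong not (anyB-intro {P = reducibleAt π} (∈-upTo⁺ lt) e)

  isSepReducibleOrOne : List ℕ → Bool
  isSepReducibleOrOne α = isSep α ∧ (isOne α ∨ not (isIrr α))

  -- Canonical cuts: the last ⊕ cut (β irreducible) and the first ⊖ cut (α is 1 or reducible).
  isDirectDecompAt : ℕ → List ℕ → Bool
  isDirectDecompAt i w = not (i ≡ᵇ 0) ∧ ((i <ᵇ length w) ∧ (allLess (take i w) (drop i w) ∧
    (isSep (std (take i w)) ∧ (isSep (std (drop i w)) ∧ isIrr (std (drop i w))))))

  isSkewDecompAt : ℕ → List ℕ → Bool
  isSkewDecompAt i w = not (i ≡ᵇ 0) ∧ ((i <ᵇ length w) ∧ (allLess (drop i w) (take i w) ∧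
    (isSepReducibleOrOne (std (take i w)) ∧ isSep (std (drop i w)))))

  DirectDecompAt : ℕ → List ℕ → Set
  DirectDecompAt i w = 0 < i × i < length w × allLess (take i w) (drop i w) ≡ true × Separable (std (take i w)) × Separable (std (drop i w)) × isIrr (std (drop i w)) ≡ true

  SkewDecompAt : ℕ → List ℕ → Set
  SkewDecompAt i w = 0 < i × i < length w × allLess (drop i w) (take i w) ≡ true × isSepReducibleOrOne (std (take i w)) ≡ true × Separable (std (drop i w))

  isDirectDecompAt⁻ : ∀ i w → isDirectDecompAt i w ≡ true → DirectDecompAt i w
  isDirectDecompAt⁻ zero w ()
  isDirectDecompAt⁻ (suc i) w h =
    let (h1 , h2) = ∧-true⁻ {suc i <ᵇ length w} h ; (h3 , h4) = ∧-true⁻ {allLess (take (suc i) w) (drop (suc i) w)} h2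
        (h5 , h6) = ∧-true⁻ {isSep (std (take (suc i) w))} h4 ; (h7 , h8) = ∧-true⁻ {isSep (std (drop (suc i) w))} h6
    in s≤s z≤n , <ᵇ-true⇒< h1 , h3 , h5 , h7 , h8

  isDirectDecompAt⁺ : ∀ i w → DirectDecompAt i w → isDirectDecompAt i w ≡ true
  isDirectDecompAt⁺ (suc i) w (_ , a , b , c , d , e) rewrite <⇒<ᵇ-true a | b | c | d | e = refl

  isSkewDecompAt⁻ : ∀ i w → isSkewDecompAt i w ≡ true → SkewDecompAt i w
  isSkewDecompAt⁻ zero w ()
  isSkewDecompAt⁻ (suc i) w h =
    let (h1 , h2) = ∧-true⁻ {suc i <ᵇ length w} h ; (h3 , h4) = ∧-true⁻ {allLess (drop (suc i) w) (take (suc i) w)} h2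
        (h5 , h6) = ∧-true⁻ {isSepReducibleOrOne (std (take (suc i) w))} h4
    in s≤s z≤n , <ᵇ-true⇒< h1 , h3 , h5 , h6

  isSkewDecompAt⁺ : ∀ i w → SkewDecompAt i w → isSkewDecompAt i w ≡ true
  isSkewDecompAt⁺ (suc i) w (_ , a , b , c , d) rewrite <⇒<ᵇ-true a | b | c | d = refl

  isSepReducibleOrOne⇒Separable : ∀ α → isSepReducibleOrOne α ≡ true → Separable α
  isSepReducibleOrOne⇒Separable α h = proj₁ (∧-true⁻ {isSep α} h)

  directDecomp⇒reducible : ∀ i w → isDirectDecompAt i w ≡ true → Separable w × isIrr w ≡ false
  directDecomp⇒reducible i w h with isDirectDecompAt⁻ i w h
  ... | i>0 , lt , al , sT , sD , _ = isSepSplit⇒isSep w i lt (isSepSplit⁺ w i i>0 lt (∨-true⁺ˡ al) sT sD) , split⇒reducible w i i>0 lt al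

  skewDecomp⇒irreducible : ∀ i w → isSkewDecompAt i w ≡ true → Separable w × isIrr w ≡ true
  skewDecomp⇒irreducible i w h with isSkewDecompAt⁻ i w h
  ... | i>0 , lt , al , sk , sD = isSepSplit⇒isSep w i lt (isSepSplit⁺ w i i>0 lt (∨-true⁺ʳ {allLess (take i w) (drop i w)} al) (isSepReducibleOrOne⇒Separable (std (take i w)) sk) sD) , irrT
    where
    irrT : isIrr w ≡ true
    irrT with isIrr w in e
    ... | true = refl
    ... | false with reducible⇒split w e
    ... | k , k>0 , klt , alk = ⊥-elim (splitsAs-exclusive true w k i k>0 klt i>0 lt alk al)

  direct-skew-exclusive : ∀ i i' w → isDirectDecompAt i w ≡ true → isSkewDecompAt i' w ≡ true → ⊥
  direct-skew-exclusive i i' w h h' with isDirectDecompAt⁻ i w h | isSkewDecompAt⁻ i' w h'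
  ... | i>0 , lt , al , _ | i'>0 , lt' , al' , _ = splitsAs-exclusive true w i i' i>0 lt i'>0 lt' al al'

  directDecomp-unique-< : ∀ i i' w → i < i' → isDirectDecompAt i w ≡ true → isDirectDecompAt i' w ≡ true → ⊥
  directDecomp-unique-< i i' w ii' h h' with isDirectDecompAt⁻ i w h | isDirectDecompAt⁻ i' w h'
  ... | i>0 , lt , al , sT , sD , irr | i'>0 , lt' , al' , _ =
    true≢false (trans (sym irr) (split⇒reducible ρ e (m<n⇒0<n∸m ii') elt cρ))
    where
    e = i' ∸ i
    eqk : i + e ≡ i'
    eqk = m+[n∸m]≡n (<⇒≤ ii')
    D0 = drop i w
    ρ = std D0
    elt : e < length ρ
    elt = subst (e <_) (sym (length-std-drop i w)) (+<⇒<∸ i e (length w) (subst (_< length w) (sym eqk) lt'))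
    al'' : allLess (take (i + e) w) (drop (i + e) w) ≡ true
    al'' = subst (λ z → allLess (take z w) (drop z w) ≡ true) (sym eqk) al'
    cρ : allLess (take e ρ) (drop e ρ) ≡ true
    cρ = trans (splitsAs-std true e D0) (splitsAs-⊆ true al'' (take-drop-⊆ i e w) (drop-drop-⊆ i e w))

  directDecomp-unique : ∀ i i' w → isDirectDecompAt i w ≡ true → isDirectDecompAt i' w ≡ true → i ≡ i'
  directDecomp-unique i i' w h h' with <-cmp i i'
  ... | tri≈ _ e _ = e
  ... | tri< lt _ _ = ⊥-elim (directDecomp-unique-< i i' w lt h h')
  ... | tri> _ _ gt = ⊥-elim (directDecomp-unique-< i' i w gt h' h)

  skewDecomp-unique-< : ∀ i i' w → i < i' → isSkewDecompAt i w ≡ true → isSkewDecompAt i' w ≡ true → ⊥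
  skewDecomp-unique-< i i' w ii' h h' with isSkewDecompAt⁻ i w h | isSkewDecompAt⁻ i' w h'
  ... | i>0 , lt , al , _ | i'>0 , lt' , al' , sk' , _ = go (∨-true⁻ (proj₂ (∧-true⁻ {isSep σ} sk')))
    where
    front = take i' w
    σ = std front
    lenσ : length σ ≡ i'
    lenσ = length-std-take i' w (<⇒≤ lt')
    cσ : splitsAs false (take i σ) (drop i σ) ≡ true
    cσ = trans (splitsAs-std false i front) (splitsAs-⊆ false al (take-take-⊆ i i' w) (drop-take-⊆ i i' w))
    go : isOne σ ≡ true ⊎ not (isIrr σ) ≡ true → ⊥
    go (inj₁ e) = true≢false (trans (sym e) (isOne-length≥2 σ (subst (2 ≤_) (sym lenσ) (≤-<-trans i>0 ii'))))
    go (inj₂ e) with reducible⇒split σ (not-true⁻ e)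
    ... | j , j>0 , jlt , alj = splitsAs-exclusive true σ j i j>0 jlt i>0 (subst (i <_) (sym lenσ) ii') alj cσ

  skewDecomp-unique : ∀ i i' w → isSkewDecompAt i w ≡ true → isSkewDecompAt i' w ≡ true → i ≡ i'
  skewDecomp-unique i i' w h h' with <-cmp i i'
  ... | tri≈ _ e _ = e
  ... | tri< lt _ _ = ⊥-elim (skewDecomp-unique-< i i' w lt h h')
  ... | tri> _ _ gt = ⊥-elim (skewDecomp-unique-< i' i w gt h' h)

  nonzeroGuard⇒pos : ∀ {X} m → (not (m ≡ᵇ 0) ∧ X) ≡ true → 0 < m
  nonzeroGuard⇒pos (suc _) _ = s≤s z≤n

  reducible⇒directDecomp : ∀ w → Separable w → isIrr w ≡ false → Σ ℕ λ i → i < length w × isDirectDecompAt i w ≡ true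
  reducible⇒directDecomp w s irr with reducible⇒split w irr
  ... | k , k>0 , klt , alk with greatestWitness (reducibleAt w) (length w) k klt (lemI k k>0 alk)
    where
    lemI : ∀ k → 0 < k → allLess (take k w) (drop k w) ≡ true → reducibleAt w k ≡ true
    lemI (suc k) _ e = e
  ... | m , mlt , dm , mx = m , mlt , isDirectDecompAt⁺ m w (m>0 , mlt , alm , proj₁ parts , proj₂ parts , irrρ)
    where
    m>0 : 0 < m
    m>0 = nonzeroGuard⇒pos m dm
    alm : allLess (take m w) (drop m w) ≡ true
    alm = proj₂ (∧-true⁻ {not (m ≡ᵇ 0)} dm)
    parts = separableParts true w m s m>0 mlt alm
    D0 = drop m w
    ρ = std D0
    irrρ : isIrr ρ ≡ true
    irrρ with isIrr ρ in e
    ... | true = refl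
    ... | false with reducible⇒split ρ e
    ... | j , j>0 , jlt , alj = ⊥-elim (true≢false (trans (sym dmj) (mx (m + j) (m<m+n m j>0) mjlt)))
      where
      jlt' : j < length w ∸ m
      jlt' = subst (j <_) (length-std-drop m w) jlt
      mjlt : m + j < length w
      mjlt = subst (m + j <_) (m+[n∸m]≡n (<⇒≤ mlt)) (+-monoʳ-< m jlt')
      alj' : AllLess (take j D0) (drop j D0)
      alj' = allLess⇒AllLess _ _ (trans (sym (splitsAs-std true j D0)) alj)
      alw : AllLess (take (m + j) w) (drop (m + j) w)
      alw {x} {y} mx' my' with ∈-++⁻ (take m w) (subst (x ∈_) (take-+ m j w) mx')
      ... | inj₁ xm = allLess⇒AllLess _ _ alm xm (drop-⊆ j D0 (subst (y ∈_) (sym (drop-drop m j w)) my'))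
      ... | inj₂ xj = alj' xj (subst (y ∈_) (sym (drop-drop m j w)) my')
      dmj : reducibleAt w (m + j) ≡ true
      dmj = lemI' (m + j) (≤-trans j>0 (m≤n+m j m)) (AllLess⇒allLess _ _ alw)
        where
        lemI' : ∀ k → 0 < k → allLess (take k w) (drop k w) ≡ true → reducibleAt w k ≡ true
        lemI' (suc k) _ e = e

  skewSplitAt : List ℕ → ℕ → Bool
  skewSplitAt w k = not (k ≡ᵇ 0) ∧ allLess (drop k w) (take k w)

  std-singleton : ∀ x → std (x ∷ []) ≡ suc zero ∷ []
  std-singleton x rewrite n<ᵇn≡false x = refl

  firstSkewBlock-reducibleOrOne : ∀ w m → 0 < m → m < length w → Separable (std (take m w)) → (∀ j → j < m → skewSplitAt w j ≡ false) →
    allLess (drop m w) (take m w) ≡ true → (isOne (std (take m w)) ∨ not (isIrr (std (take m w)))) ≡ true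
  firstSkewBlock-reducibleOrOne (x ∷ w') (suc zero) _ _ _ _ _ = ∨-true⁺ˡ (cong isOne (std-singleton x))
  firstSkewBlock-reducibleOrOne w (suc (suc m')) _ mlt sσ mn almb with isSep⇒one⊎split σ sσ
    where σ = std (take (suc (suc m')) w)
  ... | inj₁ e = ⊥-elim (1+n≢0 (suc-injective (trans (sym lenσ) (cong length e))))
    where lenσ = length-std-take (suc (suc m')) w (<⇒≤ mlt)
  ... | inj₂ (j , jlt , okj) with isSepSplit⁻ (std (take (suc (suc m')) w)) j okj
  ... | (j>0 , cj , _ , _) with allLess∨⇒splitsAs true {take j (std (take (suc (suc m')) w))} {drop j (std (take (suc (suc m')) w))} cj
  ... | inj₁ psj = ∨-true⁺ʳ {isOne (std (take (suc (suc m')) w))} (cong not (split⇒reducible (std (take (suc (suc m')) w)) j j>0 jlt psj))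
  ... | inj₂ msj = ⊥-elim (true≢false (trans (sym (lemM2 j j>0 (AllLess⇒allLess _ _ alw))) (mn j jm)))
      where
      Tm = take (suc (suc m')) w
      σ = std Tm
      lenσ' : length σ ≡ suc (suc m')
      lenσ' = length-std-take (suc (suc m')) w (<⇒≤ mlt)
      jm : j < suc (suc m')
      jm = subst (j <_) lenσ' jlt
      msT : AllLess (drop j Tm) (take j Tm)
      msT = allLess⇒AllLess (drop j Tm) (take j Tm) (trans (sym (splitsAs-std false j Tm)) msj)
      almw : AllLess (drop (suc (suc m')) w) Tm
      almw = allLess⇒AllLess _ _ almb
      tj : take j Tm ≡ take j w
      tj = take-take≤ j (suc (suc m')) w (<⇒≤ jm)
      alw : AllLess (drop j w) (take j w)
      alw {y} {x} my mx with ∈-++⁻ (drop j Tm) (subst (y ∈_) (drop-take-++ j (suc (suc m')) w (<⇒≤ jm)) my)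
      ... | inj₁ y1 = msT y1 (subst (x ∈_) (sym tj) mx)
      ... | inj₂ y2 = almw y2 (take-⊆ j Tm (subst (x ∈_) (sym tj) mx))
      lemM2 : ∀ k → 0 < k → allLess (drop k w) (take k w) ≡ true → skewSplitAt w k ≡ true
      lemM2 (suc k) _ e = e

  irreducible⇒skewDecomp : ∀ w → Separable w → isOne w ≡ false → isIrr w ≡ true → Σ ℕ λ i → i < length w × isSkewDecompAt i w ≡ true
  irreducible⇒skewDecomp w s one irr with isSep⇒one⊎split w s
  ... | inj₁ refl = ⊥-elim (true≢false one)
  ... | inj₂ (k0 , lt0 , ok) with isSepSplit⁻ w k0 ok
  ... | (k0>0 , c0 , sT0 , sD0) with allLess∨⇒splitsAs true {take k0 w} {drop k0 w} c0
  ... | inj₁ ps = ⊥-elim (true≢false (trans (sym irr) (split⇒reducible w k0 k0>0 lt0 ps)))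
  ... | inj₂ ms with leastWitness (skewSplitAt w) k0 (lemM k0 k0>0 ms)
    where
    lemM : ∀ k → 0 < k → allLess (drop k w) (take k w) ≡ true → skewSplitAt w k ≡ true
    lemM (suc k) _ e = e
  ... | m , mk0 , dm , mn = m , mlt , isSkewDecompAt⁺ m w (m>0 , mlt , alm , ∧-true⁺ (proj₁ parts) (firstSkewBlock-reducibleOrOne w m m>0 mlt (proj₁ parts) mn alm) , proj₂ parts)
    where
    m>0 : 0 < m
    m>0 = nonzeroGuard⇒pos m dm
    mlt : m < length w
    mlt = ≤-<-trans mk0 lt0
    alm : allLess (drop m w) (take m w) ≡ true
    alm = proj₂ (∧-true⁻ {not (m ≡ᵇ 0)} dm)
    parts = separableParts false w m s m>0 mlt alm
    front = take m w
    σ = std front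
    lenσ : length σ ≡ m
    lenσ = length-std-take m w (<⇒≤ mlt)

  eqList : List ℕ → List ℕ → Bool
  eqList [] [] = true
  eqList (a ∷ u) (b ∷ v) = (a ≡ᵇ b) ∧ eqList u v
  eqList _ _ = false

  eqList⇒≡ : ∀ u v → eqList u v ≡ true → u ≡ v
  eqList⇒≡ [] [] _ = refl
  eqList⇒≡ (a ∷ u) (b ∷ v) h = cong₂ _∷_ (≡ᵇ-true⇒≡ (proj₁ (∧-true⁻ {a ≡ᵇ b} h))) (eqList⇒≡ u v (proj₂ (∧-true⁻ {a ≡ᵇ b} h)))

  eqList-refl : ∀ u → eqList u u ≡ true
  eqList-refl [] = refl
  eqList-refl (a ∷ u) rewrite ≡⇒≡ᵇ-true {a} {a} refl = eqList-refl u

  ∈-concatMap⁻ : ∀ {A B : Set} (f : A → List B) (L : List A) {x} → x ∈ concatMap f L → Σ A λ y → y ∈ L × x ∈ f y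
  ∈-concatMap⁻ f (a ∷ L) m with ∈-++⁻ (f a) m
  ... | inj₁ m1 = a , here refl , m1
  ... | inj₂ m2 with ∈-concatMap⁻ f L m2
  ... | y , my , mx = y , there my , mx

  ∈-filterB⁻ : ∀ {A : Set} (P : A → Bool) L {x} → x ∈ filterB P L → x ∈ L × P x ≡ true
  ∈-filterB⁻ P (a ∷ L) m with P a in e
  ∈-filterB⁻ P (a ∷ L) (here refl) | true = here refl , e
  ∈-filterB⁻ P (a ∷ L) (there m) | true = there (proj₁ (∈-filterB⁻ P L m)) , proj₂ (∈-filterB⁻ P L m)
  ... | false = there (proj₁ (∈-filterB⁻ P L m)) , proj₂ (∈-filterB⁻ P L m)

  countB-concatMap : ∀ {A B : Set} (P : B → Bool) (f : A → List B) L → countB P (concatMap f L) ≡ sum (map (λ y → countB P (f y)) L)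
  countB-concatMap P f [] = refl
  countB-concatMap P f (a ∷ L) = trans (countB-++ (f a) (concatMap f L)) (cong (countB P (f a) +_) (countB-concatMap P f L))

  sum-indicator : ∀ {A : Set} (P : A → Bool) (c : ℕ) L → sum (map (λ y → if P y then c else 0) L) ≡ countB P L * c
  sum-indicator P c [] = refl
  sum-indicator P c (a ∷ L) with P a
  ... | true = cong (c +_) (sum-indicator P c L)
  ... | false = sum-indicator P c L

  countB-eqList-filterB : ∀ (P : List ℕ → Bool) w L → P w ≡ true → countB (λ b → eqList b w) (filterB P L) ≡ countB (λ b → eqList b w) L
  countB-eqList-filterB P w [] h = refl
  countB-eqList-filterB P w (b ∷ L) h with P b in e
  ... | true = cong ((if eqList b w then 1 else 0) +_) (countB-eqList-filterB P w L h)
  ... | false with eqList b w in e2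
  ... | true = ⊥-elim (false≢true (trans (sym e) (trans (cong P (eqList⇒≡ b w e2)) h)))
  ... | false = countB-eqList-filterB P w L h

  occ : ℕ → List ℕ → ℕ
  occ k w = countB (λ a → a ≡ᵇ k) w

  occ-pos : ∀ {k w} → k ∈ w → 1 ≤ occ k w
  occ-pos {k} {a ∷ w} (here refl) rewrite ≡⇒≡ᵇ-true {k} {k} refl = s≤s z≤n
  occ-pos {k} {a ∷ w} (there m) = ≤-trans (occ-pos m) (m≤n+m _ _)

  countB-add : ∀ {A : Set} (P Q R : A → Bool) L → (∀ a → (if P a then 1 else 0) + (if Q a then 1 else 0) ≡ (if R a then 1 else 0)) →
    countB P L + countB Q L ≡ countB R L
  countB-add P Q R [] h = refl
  countB-add P Q R (a ∷ L) h =
    trans (+-interchange (if P a then 1 else 0) (countB P L) (if Q a then 1 else 0) (countB Q L))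
          (cong₂ _+_ (h a) (countB-add P Q R L h))

  oneTo-suc : ∀ m → oneTo (suc m) ≡ oneTo m ++ [ suc m ]
  oneTo-suc m = trans (cong (map suc) (sym (upTo-∷ʳ m))) (map-++ suc (upTo m) [ m ])

  inOneTo : ℕ → ℕ → Bool
  inOneTo m a = (0 <ᵇ a) ∧ (a <ᵇ suc m)

  sum-occ-oneTo : ∀ w m → sum (map (λ k → occ k w) (oneTo m)) ≡ countB (inOneTo m) w
  sum-occ-oneTo w zero = sym (countB-zero w (λ {a} _ → lem a))
    where lem : ∀ a → inOneTo zero a ≡ false
          lem zero = refl
          lem (suc a) = refl
  sum-occ-oneTo w (suc m) =
    begin
      sum (map (λ k → occ k w) (oneTo (suc m)))
        ≡⟨ cong (λ z → sum (map (λ k → occ k w) z)) (oneTo-suc m) ⟩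
      sum (map (λ k → occ k w) (oneTo m ++ [ suc m ]))
        ≡⟨ cong sum (map-++ (λ k → occ k w) (oneTo m) [ suc m ]) ⟩
      sum (map (λ k → occ k w) (oneTo m) ++ [ occ (suc m) w ])
        ≡⟨ sum-++ (map (λ k → occ k w) (oneTo m)) [ occ (suc m) w ] ⟩
      sum (map (λ k → occ k w) (oneTo m)) + (occ (suc m) w + 0)
        ≡⟨ cong₂ _+_ (sum-occ-oneTo w m) (+-identityʳ _) ⟩
      countB (inOneTo m) w + occ (suc m) w
        ≡⟨ countB-add (inOneTo m) (λ a → a ≡ᵇ suc m) (inOneTo (suc m)) w pt ⟩
      countB (inOneTo (suc m)) w ∎
    where
    pt : ∀ a → (if inOneTo m a then 1 else 0) + (if a ≡ᵇ suc m then 1 else 0) ≡ (if inOneTo (suc m) a then 1 else 0)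
    pt zero = refl
    pt (suc a) with <-cmp a m
    ... | tri< lt ne _ rewrite <⇒<ᵇ-true lt | ≢⇒≡ᵇ-false ne | <⇒<ᵇ-true (m<n⇒m<1+n lt) = refl
    ... | tri≈ nlt refl _ rewrite ≮⇒<ᵇ-false nlt | ≡⇒≡ᵇ-true {a} {a} refl | <⇒<ᵇ-true (n<1+n a) = refl
    ... | tri> nlt ne gt rewrite ≮⇒<ᵇ-false nlt | ≢⇒≡ᵇ-false ne | ≮⇒<ᵇ-false (λ h → <⇒≱ gt (≤-pred h)) = refl

  sum-ones : ∀ (f : ℕ → ℕ) L → (∀ {x} → x ∈ L → f x ≡ 1) → sum (map f L) ≡ length L
  sum-ones f [] h = refl
  sum-ones f (a ∷ L) h = cong₂ _+_ (h (here refl)) (sum-ones f L (λ m → h (there m)))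

  length-oneTo : ∀ m → length (oneTo m) ≡ m
  length-oneTo m = trans (length-map suc (upTo m)) (length-upTo m)

  ∈-oneTo : ∀ {k m} → 1 ≤ k → k ≤ m → k ∈ oneTo m
  ∈-oneTo {suc k} {m} _ le = ∈-map⁺ suc (∈-upTo⁺ le)

  ∈-oneTo⁻ : ∀ {k m} → k ∈ oneTo m → 1 ≤ k × k ≤ m
  ∈-oneTo⁻ {k} {m} mk with ∈-map⁻ suc mk
  ... | j , mj , refl = s≤s z≤n , ∈-upTo⁻ mj

  InRange : ℕ → List ℕ → Set
  InRange n w = ∀ {a} → a ∈ w → 1 ≤ a × a ≤ n

  isPerm⇒occ≡1 : ∀ n w → isPerm n w ≡ true → ∀ k → 1 ≤ k → k ≤ n → occ k w ≡ 1
  isPerm⇒occ≡1 n w h k k1 kn = ≡ᵇ-true⇒≡ (allB-∈ h (∈-oneTo k1 kn))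

  occ≡1⇒isPerm : ∀ n w → (∀ k → 1 ≤ k → k ≤ n → occ k w ≡ 1) → isPerm n w ≡ true
  occ≡1⇒isPerm n w h = allB-intro (oneTo n) (λ {k} mk → ≡⇒≡ᵇ-true (h k (proj₁ (∈-oneTo⁻ mk)) (proj₂ (∈-oneTo⁻ mk))))

  occ≡1⇒Distinct : ∀ w → (∀ {a} → a ∈ w → occ a w ≡ 1) → Distinct w
  occ≡1⇒Distinct [] h = tt
  occ≡1⇒Distinct (b ∷ w) h = nb , occ≡1⇒Distinct w rec
    where
    hb : occ b (b ∷ w) ≡ 1
    hb = h (here refl)
    cb0 : occ b w ≡ 0
    cb0 = suc-injective (trans (cong (_+ occ b w) (sym (cong (λ z → if z then 1 else 0) (≡⇒≡ᵇ-true {b} {b} refl)))) hb)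
    nb : b ∉ w
    nb m = <⇒≱ (occ-pos m) (≤-reflexive cb0)
    rec : ∀ {a} → a ∈ w → occ a w ≡ 1
    rec {a} m = ≤-antisym (≤-trans (m≤n+m (occ a w) (if b ≡ᵇ a then 1 else 0)) (≤-reflexive (h (there m)))) (occ-pos m)

  Distinct⇒occ≤1 : ∀ ws → Distinct ws → ∀ k → occ k ws ≤ 1
  Distinct⇒occ≤1 [] d k = z≤n
  Distinct⇒occ≤1 (b ∷ ws) (nb , d) k with b ≡ᵇ k in e
  ... | false = Distinct⇒occ≤1 ws d k
  ... | true = s≤s (≤-reflexive (countB-zero ws (λ {x} mx → ≢⇒≡ᵇ-false (λ ex → nb (subst (_∈ ws) (trans ex (sym (≡ᵇ-true⇒≡ e))) mx)))))

  sum≡length⇒all≡1 : ∀ xs → (∀ {x} → x ∈ xs → x ≤ 1) → sum xs ≡ length xs → ∀ {x} → x ∈ xs → x ≡ 1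
  sum≡length⇒all≡1 (x0 ∷ xs) le h m = go (le (here refl)) m
    where
    sle : ∀ ys → (∀ {x} → x ∈ ys → x ≤ 1) → sum ys ≤ length ys
    sle [] _ = z≤n
    sle (y ∷ ys) l = +-mono-≤ (l (here refl)) (sle ys (λ m → l (there m)))
    go : x0 ≤ 1 → ∀ {x} → x ∈ x0 ∷ xs → x ≡ 1
    go z≤n _ = ⊥-elim (<⇒≱ (≤-reflexive (sym h)) (sle xs (λ m → le (there m))))
    go (s≤s z≤n) (here refl) = refl
    go (s≤s z≤n) (there m) = sum≡length⇒all≡1 xs (λ m → le (there m)) (suc-injective h) m

  isPerm⇒IsPerm : ∀ n w → length w ≡ n → InRange n w → isPerm n w ≡ true → IsPerm n w
  isPerm⇒IsPerm n w len ir ip = len , occ≡1⇒Distinct w (λ m → isPerm⇒occ≡1 n w ip _ (proj₁ (ir m)) (proj₂ (ir m))) , sd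
    where
    sd : std w ≡ w
    sd = map-id-∈ w λ {a} ma → lem a ma (ir ma)
      where
      lem : ∀ a → a ∈ w → 1 ≤ a × a ≤ n → rank w a ≡ a
      lem (suc m) ma (_ , le) = cong suc (
        begin
          countB (λ c → c <ᵇ suc m) w ≡⟨ countB-cong w (λ {c} mc → pt c (proj₁ (ir mc))) ⟩
          countB (inOneTo m) w ≡⟨ sym (sum-occ-oneTo w m) ⟩
          sum (map (λ k → occ k w) (oneTo m)) ≡⟨ sum-ones (λ k → occ k w) (oneTo m)
               (λ mk → isPerm⇒occ≡1 n w ip _ (proj₁ (∈-oneTo⁻ mk)) (≤-trans (proj₂ (∈-oneTo⁻ mk)) (≤-trans (n≤1+n m) le))) ⟩
          length (oneTo m) ≡⟨ length-oneTo m ⟩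
          m ∎)
        where
        pt : ∀ c → 1 ≤ c → (c <ᵇ suc m) ≡ inOneTo m c
        pt (suc c) _ = refl

  IsPerm⇒isPerm : ∀ n w → IsPerm n w → isPerm n w ≡ true
  IsPerm⇒isPerm n w p@(len , d , s) = occ≡1⇒isPerm n w λ k k1 kn →
    sum≡length⇒all≡1 xs (λ {x} mx → le1 mx) sumEq (∈-map⁺ (λ k → occ k w) (∈-oneTo k1 kn))
    where
    xs = map (λ k → occ k w) (oneTo n)
    le1 : ∀ {x} → x ∈ xs → x ≤ 1
    le1 mx with ∈-map⁻ (λ k → occ k w) mx
    ... | k , _ , refl = Distinct⇒occ≤1 w d k
    sumEq : sum xs ≡ length xs
    sumEq = trans (sum-occ-oneTo w n) (trans (countB-all w (λ {a} ma → pt a (IsPerm-range p ma)))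
              (trans len (sym (trans (length-map _ (oneTo n)) (length-oneTo n)))))
      where
      pt : ∀ a → 1 ≤ a × a ≤ n → inOneTo n a ≡ true
      pt (suc a) (_ , le) = <⇒<ᵇ-true (s≤s le)

  ∈-words⁻ : ∀ n k {w} → w ∈ words n k → length w ≡ k × InRange n w
  ∈-words⁻ n zero (here refl) = refl , λ ()
  ∈-words⁻ n (suc k) {w} m with ∈-concatMap⁻ (λ v → map (λ a → a ∷ v) (oneTo n)) (words n k) m
  ... | v , mv , mw with ∈-map⁻ (λ a → a ∷ v) mw
  ... | a , ma , refl = cong suc (proj₁ (∈-words⁻ n k mv)) , ir
    where
    ir : InRange n (a ∷ v)
    ir (here refl) = ∈-oneTo⁻ ma
    ir (there m') = proj₂ (∈-words⁻ n k mv) m'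

  count-upTo : ∀ n a → a < n → countB (λ c → c ≡ᵇ a) (upTo n) ≡ 1
  count-upTo (suc n) a lt with m≤n⇒m<n∨m≡n (≤-pred lt)
  ... | inj₁ a<n =
    begin
      countB (λ c → c ≡ᵇ a) (upTo (suc n)) ≡⟨ cong (countB (λ c → c ≡ᵇ a)) (sym (upTo-∷ʳ n)) ⟩
      countB (λ c → c ≡ᵇ a) (upTo n ++ [ n ]) ≡⟨ countB-++ (upTo n) [ n ] ⟩
      countB (λ c → c ≡ᵇ a) (upTo n) + countB (λ c → c ≡ᵇ a) [ n ] ≡⟨ cong₂ _+_ (count-upTo n a a<n) (cong (λ z → (if z then 1 else 0) + 0) (≢⇒≡ᵇ-false (λ e → <⇒≢ a<n (sym e)))) ⟩
      1 ∎
  ... | inj₂ refl =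
    begin
      countB (λ c → c ≡ᵇ a) (upTo (suc a)) ≡⟨ cong (countB (λ c → c ≡ᵇ a)) (sym (upTo-∷ʳ a)) ⟩
      countB (λ c → c ≡ᵇ a) (upTo a ++ [ a ]) ≡⟨ countB-++ (upTo a) [ a ] ⟩
      countB (λ c → c ≡ᵇ a) (upTo a) + countB (λ c → c ≡ᵇ a) [ a ] ≡⟨ cong₂ _+_ (countB-zero (upTo a) (λ mc → ≢⇒≡ᵇ-false (<⇒≢ (∈-upTo⁻ mc)))) (cong (λ z → (if z then 1 else 0) + 0) (≡⇒≡ᵇ-true {a} {a} refl)) ⟩
      1 ∎

  count-oneTo : ∀ n a → 1 ≤ a → a ≤ n → countB (λ c → c ≡ᵇ a) (oneTo n) ≡ 1
  count-oneTo n (suc a) _ le = trans (countB-map suc (upTo n)) (count-upTo n a le)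

  words-count : ∀ n k w → length w ≡ k → InRange n w → countB (λ b → eqList b w) (words n k) ≡ 1
  words-count n zero [] _ _ = refl
  words-count n (suc k) (a ∷ v) len ir =
    begin
      countB (λ b → eqList b (a ∷ v)) (concatMap (λ y → map (λ c → c ∷ y) (oneTo n)) (words n k))
        ≡⟨ countB-concatMap (λ b → eqList b (a ∷ v)) (λ y → map (λ c → c ∷ y) (oneTo n)) (words n k) ⟩
      sum (map (λ y → countB (λ b → eqList b (a ∷ v)) (map (λ c → c ∷ y) (oneTo n))) (words n k))
        ≡⟨ cong sum (map-cong-∈ (words n k) (λ {y} _ → inner y)) ⟩
      sum (map (λ y → if eqList y v then 1 else 0) (words n k))
        ≡⟨ sum-indicator (λ y → eqList y v) 1 (words n k) ⟩
      countB (λ y → eqList y v) (words n k) * 1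
        ≡⟨ cong (_* 1) (words-count n k v (suc-injective len) (λ m → ir (there m))) ⟩
      1 ∎
    where
    inner : ∀ y → countB (λ b → eqList b (a ∷ v)) (map (λ c → c ∷ y) (oneTo n)) ≡ (if eqList y v then 1 else 0)
    inner y with eqList y v in ev
    ... | true = trans (countB-map (λ c → c ∷ y) (oneTo n))
                   (trans (countB-cong (oneTo n) (λ {c} _ → trans (cong ((c ≡ᵇ a) ∧_) ev) (∧-identityʳ (c ≡ᵇ a)))) (count-oneTo n a (proj₁ (ir (here refl))) (proj₂ (ir (here refl)))))
    ... | false = trans (countB-map (λ c → c ∷ y) (oneTo n)) (countB-zero (oneTo n) (λ {c} _ → trans (cong ((c ≡ᵇ a) ∧_) ev) (∧-zeroʳ (c ≡ᵇ a))))

  ∈-perms⇒IsPerm : ∀ n {w} → w ∈ perms n → IsPerm n w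
  ∈-perms⇒IsPerm n m with ∈-filterB⁻ (isPerm n) (words n n) m
  ... | mw , ip = isPerm⇒IsPerm n _ (proj₁ (∈-words⁻ n n mw)) (proj₂ (∈-words⁻ n n mw)) ip

  perms-count : ∀ n w → IsPerm n w → countB (λ b → eqList b w) (perms n) ≡ 1
  perms-count n w p = trans (countB-eqList-filterB (isPerm n) w (words n n) (IsPerm⇒isPerm n w p)) (words-count n n w (proj₁ p) (IsPerm-range p))

  -- Statistics of direct and skew sums

  indicator : Bool → ℕ
  indicator b = if b then 1 else 0

  adjCount-map : ∀ (R : ℕ → ℕ → Bool) h w → (∀ {a b} → a ∈ w → b ∈ w → R (h a) (h b) ≡ R a b) → adjCount R (map h w) ≡ adjCount R w
  adjCount-map R h [] e = refl
  adjCount-map R h (a ∷ []) e = refl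
  adjCount-map R h (a ∷ b ∷ w) e =
    cong₂ (λ x y → indicator x + y) (e (here refl) (there (here refl))) (adjCount-map R h (b ∷ w) (λ ma mb → e (there ma) (there mb)))

  leftRecords-map : ∀ (R : ℕ → ℕ → Bool) h S → (∀ {a b} → a ∈ S → b ∈ S → R (h a) (h b) ≡ R a b) →
    ∀ acc w → acc ⊆ S → w ⊆ S → leftRecords R (map h acc) (map h w) ≡ leftRecords R acc w
  leftRecords-map R h S e acc [] sa sw = refl
  leftRecords-map R h S e acc (a ∷ w) sa sw =
    cong₂ (λ x y → indicator x + y)
      (trans (allB-map h acc) (allB-cong acc (λ mb → e (sa mb) (sw (here refl)))))
      (trans (cong (λ z → leftRecords R z (map h w)) (sym (map-++ h acc [ a ])))
        (leftRecords-map R h S e (acc ++ [ a ]) w sa' (λ m → sw (there m))))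
    where
    sa' : acc ++ [ a ] ⊆ S
    sa' m with ∈-++⁻ acc m
    ... | inj₁ m1 = sa m1
    ... | inj₂ (here refl) = sw (here refl)

  module Relabel {h w} (op : PreservesOrder h w) where
    opS : ∀ {a b} → a ∈ w → b ∈ w → (h b <ᵇ h a) ≡ (b <ᵇ a)
    opS ma mb = op mb ma
    asc-inv : asc (map h w) ≡ asc w
    asc-inv = adjCount-map _ h w op
    des-inv : des (map h w) ≡ des w
    des-inv = adjCount-map _ h w opS
    lmax-inv : lmax (map h w) ≡ lmax w
    lmax-inv = leftRecords-map (λ b a → b <ᵇ a) h w op [] w (λ ()) (λ m → m)
    lmin-inv : lmin (map h w) ≡ lmin w
    lmin-inv = leftRecords-map (λ b a → a <ᵇ b) h w (λ ma mb → op mb ma) [] w (λ ()) (λ m → m)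
    rmax-inv : rmax (map h w) ≡ rmax w
    rmax-inv = trans (cong lmax (sym (reverse-map h w)))
      (leftRecords-map (λ b a → b <ᵇ a) h w op [] (reverse w) (λ ()) AnyP.reverse⁻)
    rmin-inv : rmin (map h w) ≡ rmin w
    rmin-inv = trans (cong lmin (sym (reverse-map h w)))
      (leftRecords-map (λ b a → a <ᵇ b) h w (λ ma mb → op mb ma) [] (reverse w) (λ ()) AnyP.reverse⁻)

  adjCount-++ : ∀ (R : ℕ → ℕ → Bool) c x a y b → (∀ {u v} → u ∈ x ∷ a → v ∈ y ∷ b → R u v ≡ c) →
    adjCount R ((x ∷ a) ++ (y ∷ b)) ≡ adjCount R (x ∷ a) + (indicator c + adjCount R (y ∷ b))
  adjCount-++ R c x [] y b e = cong (λ z → indicator z + adjCount R (y ∷ b)) (e (here refl) (here refl))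
  adjCount-++ R c x (x2 ∷ a) y b e =
    trans (cong (indicator (R x x2) +_) (adjCount-++ R c x2 a y b (λ mu mv → e (there mu) mv)))
          (sym (+-assoc (indicator (R x x2)) _ _))

  leftRecords-++ : ∀ (R : ℕ → ℕ → Bool) acc a b → leftRecords R acc (a ++ b) ≡ leftRecords R acc a + leftRecords R (acc ++ a) b
  leftRecords-++ R acc [] b = cong (λ z → leftRecords R z b) (sym (++-identityʳ acc))
  leftRecords-++ R acc (x ∷ a) b =
    trans (cong (indicator (allB (λ c → R c x) acc) +_)
            (trans (leftRecords-++ R (acc ++ [ x ]) a b)
                   (cong (λ z → leftRecords R (acc ++ [ x ]) a + leftRecords R z b) (++-assoc acc [ x ] a))))
          (sym (+-assoc (indicator (allB (λ c → R c x) acc)) _ _))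

  leftRecords-dropPrefix : ∀ (R : ℕ → ℕ → Bool) acc1 acc2 b → (∀ {c x} → c ∈ acc1 → x ∈ b → R c x ≡ true) →
    leftRecords R (acc1 ++ acc2) b ≡ leftRecords R acc2 b
  leftRecords-dropPrefix R acc1 acc2 [] e = refl
  leftRecords-dropPrefix R acc1 acc2 (x ∷ b) e =
    cong₂ (λ u v → indicator u + v)
      (trans (allB-++ acc1 acc2) (cong (_∧ allB (λ c → R c x) acc2) (allB-intro acc1 (λ mc → e mc (here refl)))))
      (trans (cong (λ z → leftRecords R z b) (++-assoc acc1 acc2 [ x ]))
        (leftRecords-dropPrefix R acc1 (acc2 ++ [ x ]) b (λ mc mx → e mc (there mx))))

  leftRecords-zero : ∀ (R : ℕ → ℕ → Bool) acc b {c} → c ∈ acc → (∀ {x} → x ∈ b → R c x ≡ false) → leftRecords R acc b ≡ 0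
  leftRecords-zero R acc [] mc e = refl
  leftRecords-zero R acc (x ∷ b) mc e =
    cong₂ (λ u v → indicator u + v) (allB-false mc (e (here refl))) (leftRecords-zero R (acc ++ [ x ]) b (∈-++⁺ˡ mc) (λ m → e (there m)))

  leftRecords-allRelated : ∀ (R : ℕ → ℕ → Bool) acc b → (∀ {c x} → c ∈ acc → x ∈ b → R c x ≡ true) → leftRecords R acc b ≡ leftRecords R [] b
  leftRecords-allRelated R acc b e = trans (cong (λ z → leftRecords R z b) (sym (++-identityʳ acc))) (leftRecords-dropPrefix R acc [] b e)

  module Concat (x : ℕ) (a : List ℕ) (y : ℕ) (b : List ℕ) where
    A = x ∷ a
    B = y ∷ b

    module Direct (al : AllLess A B) where
      asc-++ : asc (A ++ B) ≡ asc A + (1 + asc B)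
      asc-++ = adjCount-++ _ true x a y b (λ mu mv → <⇒<ᵇ-true (al mu mv))
      des-++ : des (A ++ B) ≡ des A + (0 + des B)
      des-++ = adjCount-++ _ false x a y b (λ mu mv → ≮⇒<ᵇ-false (<⇒≯ (al mu mv)))
      lmax-++ : lmax (A ++ B) ≡ lmax A + lmax B
      lmax-++ = trans (leftRecords-++ _ [] A B) (cong (lmax A +_) (leftRecords-allRelated _ A B (λ mc mx → <⇒<ᵇ-true (al mc mx))))
      lmin-++ : lmin (A ++ B) ≡ lmin A + 0
      lmin-++ = trans (leftRecords-++ _ [] A B) (cong (lmin A +_) (leftRecords-zero _ A B (here refl) (λ mx → ≮⇒<ᵇ-false (<⇒≯ (al (here refl) mx)))))
      rmax-++ : rmax (A ++ B) ≡ rmax B + 0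
      rmax-++ = trans (cong lmax (reverse-++ A B)) (trans (leftRecords-++ _ [] (reverse B) (reverse A))
        (cong (rmax B +_) (leftRecords-zero _ (reverse B) (reverse A) (AnyP.reverse⁺ {xs = B} (here refl)) (λ mx → ≮⇒<ᵇ-false (<⇒≯ (al (AnyP.reverse⁻ mx) (here refl)))))))
      rmin-++ : rmin (A ++ B) ≡ rmin B + rmin A
      rmin-++ = trans (cong lmin (reverse-++ A B)) (trans (leftRecords-++ _ [] (reverse B) (reverse A))
        (cong (rmin B +_) (leftRecords-allRelated _ (reverse B) (reverse A) (λ mc mx → <⇒<ᵇ-true (al (AnyP.reverse⁻ mx) (AnyP.reverse⁻ mc))))))

    module Skew (al : AllLess B A) where
      asc-++ : asc (A ++ B) ≡ asc A + (0 + asc B)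
      asc-++ = adjCount-++ _ false x a y b (λ mu mv → ≮⇒<ᵇ-false (<⇒≯ (al mv mu)))
      des-++ : des (A ++ B) ≡ des A + (1 + des B)
      des-++ = adjCount-++ _ true x a y b (λ mu mv → <⇒<ᵇ-true (al mv mu))
      lmax-++ : lmax (A ++ B) ≡ lmax A + 0
      lmax-++ = trans (leftRecords-++ _ [] A B) (cong (lmax A +_) (leftRecords-zero _ A B (here refl) (λ mx → ≮⇒<ᵇ-false (<⇒≯ (al mx (here refl))))))
      lmin-++ : lmin (A ++ B) ≡ lmin A + lmin B
      lmin-++ = trans (leftRecords-++ _ [] A B) (cong (lmin A +_) (leftRecords-allRelated _ A B (λ mc mx → <⇒<ᵇ-true (al mx mc))))
      rmax-++ : rmax (A ++ B) ≡ rmax B + rmax A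
      rmax-++ = trans (cong lmax (reverse-++ A B)) (trans (leftRecords-++ _ [] (reverse B) (reverse A))
        (cong (rmax B +_) (leftRecords-allRelated _ (reverse B) (reverse A) (λ mc mx → <⇒<ᵇ-true (al (AnyP.reverse⁻ mc) (AnyP.reverse⁻ mx))))))
      rmin-++ : rmin (A ++ B) ≡ rmin B + 0
      rmin-++ = trans (cong lmin (reverse-++ A B)) (trans (leftRecords-++ _ [] (reverse B) (reverse A))
        (cong (rmin B +_) (leftRecords-zero _ (reverse B) (reverse A) (AnyP.reverse⁺ {xs = B} (here refl)) (λ mx → ≮⇒<ᵇ-false (<⇒≯ (al (here refl) (AnyP.reverse⁻ mx)))))))

  eqList-one : ∀ w → eqList w (1 ∷ []) ≡ isOne w
  eqList-one [] = refl
  eqList-one (zero ∷ w) = refl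
  eqList-one (suc zero ∷ []) = refl
  eqList-one (suc zero ∷ _ ∷ _) = refl
  eqList-one (suc (suc x) ∷ w) = refl

  isSep⇒nonempty : ∀ α → isSep α ≡ true → 0 < length α
  isSep⇒nonempty [] ()
  isSep⇒nonempty (_ ∷ _) _ = s≤s z≤n

  IsPerm-one : IsPerm 1 (1 ∷ [])
  IsPerm-one = refl , ((λ ()) , tt) , refl

  perms-count-one : ∀ n → countB (λ w → eqList w (1 ∷ [])) (perms n) ≡ (if n ≡ᵇ 1 then 1 else 0)
  perms-count-one n with n ≡ᵇ 1 in e
  ... | true with ≡ᵇ-true⇒≡ {n} {1} e
  ... | refl = perms-count 1 (1 ∷ []) IsPerm-one
  perms-count-one n | false = countB-zero (perms n) (λ {w} mw → lem w mw)
    where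
    lem : ∀ w → w ∈ perms n → eqList w (1 ∷ []) ≡ false
    lem w mw with eqList w (1 ∷ []) in e2
    ... | false = refl
    ... | true = ⊥-elim (true≢false (trans (sym (≡⇒≡ᵇ-true {n} {1} (trans (sym (proj₁ (∈-perms⇒IsPerm n mw))) (cong length (eqList⇒≡ w _ e2))))) e))

  pairs : ∀ {A B : Set} → List A → List B → List (A × B)
  pairs LA LB = concatMap (λ a → map (a ,_) LB) LA

  ∈-pairs : ∀ {A B : Set} (LA : List A) (LB : List B) {pr} → pr ∈ pairs LA LB → proj₁ pr ∈ LA × proj₂ pr ∈ LB
  ∈-pairs (a ∷ LA) LB m with ∈-++⁻ (map (a ,_) LB) m
  ... | inj₁ m1 with ∈-map⁻ (a ,_) m1
  ... | b , mb , refl = here refl , mb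
  ∈-pairs (a ∷ LA) LB m | inj₂ m2 with ∈-pairs LA LB m2
  ... | ma , mb = there ma , mb

  ⇔true⇒≡ : ∀ {x y : Bool} → (x ≡ true → y ≡ true) → (y ≡ true → x ≡ true) → x ≡ y
  ⇔true⇒≡ {false} {false} f g = refl
  ⇔true⇒≡ {false} {true} f g = g refl
  ⇔true⇒≡ {true} {false} f g = sym (f refl)
  ⇔true⇒≡ {true} {true} f g = refl

  pairs-count : ∀ LA LB α0 β0 → countB (λ ab → eqList (proj₁ ab) α0 ∧ eqList (proj₂ ab) β0) (pairs LA LB)
    ≡ countB (λ a → eqList a α0) LA * countB (λ b → eqList b β0) LB
  pairs-count LA LB α0 β0 =
    trans (countB-concatMap E (λ a → map (a ,_) LB) LA)
      (trans (cong sum (map-cong-∈ LA (λ {a} _ → inner a))) (sum-indicator (λ a → eqList a α0) _ LA))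
    where
    E : List ℕ × List ℕ → Bool
    E ab = eqList (proj₁ ab) α0 ∧ eqList (proj₂ ab) β0
    inner : ∀ a → countB E (map (a ,_) LB) ≡ (if eqList a α0 then countB (λ b → eqList b β0) LB else 0)
    inner a with eqList a α0 in e
    ... | true = trans (countB-map (a ,_) LB) (countB-cong LB (λ {b} _ → cong (_∧ eqList b β0) e))
    ... | false = trans (countB-map (a ,_) LB) (countB-zero LB (λ {b} _ → cong (_∧ eqList b β0) e))

  eqPair : List ℕ × List ℕ → List ℕ × List ℕ → Bool
  eqPair a a' = eqList (proj₁ a) (proj₁ a') ∧ eqList (proj₂ a) (proj₂ a')

  eqPair⇒≡ : ∀ a a' → eqPair a a' ≡ true → a ≡ a'
  eqPair⇒≡ (a , b) (a' , b') h = cong₂ _,_ (eqList⇒≡ a a' (proj₁ (∧-true⁻ {eqList a a'} h))) (eqList⇒≡ b b' (proj₂ (∧-true⁻ {eqList a a'} h)))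

  eqPair-refl : ∀ a → eqPair a a ≡ true
  eqPair-refl (a , b) rewrite eqList-refl a | eqList-refl b = refl

  isDirectDecompAt-one : ∀ i → isDirectDecompAt i (1 ∷ []) ≡ false
  isDirectDecompAt-one zero = refl
  isDirectDecompAt-one (suc i) = refl

  isSkewDecompAt-one : ∀ i → isSkewDecompAt i (1 ∷ []) ≡ false
  isSkewDecompAt-one zero = refl
  isSkewDecompAt-one (suc i) = refl

  isSepReducibleOrOne-notOne : ∀ α → isOne α ≡ false → isSepReducibleOrOne α ≡ (isSep α ∧ not (isIrr α))
  isSepReducibleOrOne-notOne α h = cong (λ z → isSep α ∧ (z ∨ not (isIrr α))) h

  take-drop-nonempty : ∀ (w : List ℕ) i → 0 < i → i < length w → 0 < length (take i w) × 0 < length (drop i w)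
  take-drop-nonempty w i i>0 lt =
    subst (0 <_) (sym (length-take≤ i w (<⇒≤ lt))) i>0 ,
    subst (0 <_) (sym (length-drop i w)) (m<n⇒0<n∸m lt)

module Series {c ℓ} (R : CommutativeRing c ℓ) where

  open import Data.Nat using (zero; suc; _∸_; _≤_; _<_; _≡ᵇ_) renaming (_+_ to _+ℕ_; _*_ to _*ℕ_)
  open import Data.Nat.Properties using (m+[n∸m]≡n; m<m+n; m<n⇒m<1+n; ≤-pred)
  open import Data.Bool using (Bool; true; false; _∧_; if_then_else_)
  open import Data.List using (List; []; _∷_; _++_; map; length; take; drop; concatMap; upTo)
  open import Data.List.Properties using (map-++; map-∘; take++drop≡id)
  open import Data.List.Membership.Propositional using (_∈_)
  open import Data.List.Membership.Propositional.Properties using (∈-upTo⁻)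
  open import Data.List.Relation.Unary.Any using (here; there)
  open import Relation.Binary.PropositionalEquality as P using (_≡_; cong; cong₂; subst; subst₂)
  open import Data.Product using (_,_; proj₁; proj₂)
  open import Data.Empty using (⊥-elim)
  open import Data.Vec using (_∷_; [])
  open import Data.Fin using (#_)
  open Permutations
  open CommutativeRing R hiding (zero)
  open GF R
  open import Relation.Binary.Reasoning.Setoid setoid
  open import Algebra.Properties.CommutativeSemigroup +-commutativeSemigroup using () renaming (interchange to +-interchange)
  import Algebra.Solver.CommutativeMonoid *-commutativeMonoid as CMS
  open import Algebra.Solver.Monoid.Expression *-rawMonoid using (var; id; _⊕_)

  ∑ : ∀ {A : Set} → List A → (A → Carrier) → Carrier
  ∑ L f = sumR (map f L)

  [_]? : Bool → Carrier → Carrier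
  [ b ]? x = if b then x else 0#

  sumR-++ : ∀ xs ys → sumR (xs ++ ys) ≈ sumR xs + sumR ys
  sumR-++ [] ys = sym (+-identityˡ _)
  sumR-++ (x ∷ xs) ys = trans (+-congˡ (sumR-++ xs ys)) (sym (+-assoc x _ _))

  ∑-cong : ∀ {A : Set} {f g : A → Carrier} L → (∀ {x} → x ∈ L → f x ≈ g x) → ∑ L f ≈ ∑ L g
  ∑-cong [] h = refl
  ∑-cong (a ∷ L) h = +-cong (h (here P.refl)) (∑-cong L (λ m → h (there m)))

  ∑-0 : ∀ {A : Set} {f : A → Carrier} L → (∀ {x} → x ∈ L → f x ≈ 0#) → ∑ L f ≈ 0#
  ∑-0 [] h = refl
  ∑-0 (a ∷ L) h = trans (+-cong (h (here P.refl)) (∑-0 L (λ m → h (there m)))) (+-identityˡ 0#)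

  ∑-+ : ∀ {A : Set} (f g : A → Carrier) L → ∑ L (λ x → f x + g x) ≈ ∑ L f + ∑ L g
  ∑-+ f g [] = sym (+-identityˡ 0#)
  ∑-+ f g (a ∷ L) = trans (+-congˡ (∑-+ f g L)) (+-interchange (f a) (g a) _ _)

  ∑-*ˡ : ∀ {A : Set} (k : Carrier) (f : A → Carrier) L → k * ∑ L f ≈ ∑ L (λ x → k * f x)
  ∑-*ˡ k f [] = zeroʳ k
  ∑-*ˡ k f (a ∷ L) = trans (distribˡ k (f a) _) (+-congˡ (∑-*ˡ k f L))

  ∑-*ʳ : ∀ {A : Set} (k : Carrier) (f : A → Carrier) L → ∑ L f * k ≈ ∑ L (λ x → f x * k)
  ∑-*ʳ k f [] = zeroˡ k
  ∑-*ʳ k f (a ∷ L) = trans (distribʳ k (f a) _) (+-congˡ (∑-*ʳ k f L))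

  ∑-swap : ∀ {A B : Set} (F : A → B → Carrier) (LA : List A) (LB : List B) →
    ∑ LA (λ a → ∑ LB (F a)) ≈ ∑ LB (λ b → ∑ LA (λ a → F a b))
  ∑-swap F [] LB = sym (∑-0 LB (λ _ → refl))
  ∑-swap F (a ∷ LA) LB = trans (+-congˡ (∑-swap F LA LB)) (sym (∑-+ (F a) (λ b → ∑ LA (λ a → F a b)) LB))

  ∑-concatMap : ∀ {A B : Set} (g : A → List B) (f : B → Carrier) L → ∑ (concatMap g L) f ≈ ∑ L (λ y → ∑ (g y) f)
  ∑-concatMap g f [] = refl
  ∑-concatMap g f (a ∷ L) =
    trans (reflexive (P.cong sumR (map-++ f (g a) (concatMap g L))))
      (trans (sumR-++ (map f (g a)) (map f (concatMap g L))) (+-congˡ (∑-concatMap g f L)))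

  ∑-map : ∀ {A B : Set} (g : A → B) (f : B → Carrier) L → ∑ (map g L) f ≈ ∑ L (λ x → f (g x))
  ∑-map g f L = reflexive (P.cong sumR (P.sym (map-∘ L)))

  ∑-filterB : ∀ {A : Set} (Q : A → Bool) (f : A → Carrier) L → sumR (map f (filterB Q L)) ≈ ∑ L (λ x → [ Q x ]? (f x))
  ∑-filterB Q f [] = refl
  ∑-filterB Q f (a ∷ L) with Q a
  ... | true = +-congˡ (∑-filterB Q f L)
  ... | false = trans (∑-filterB Q f L) (sym (+-identityˡ _))

  times : ℕ → Carrier → Carrier
  times zero x = 0#
  times (suc n) x = x + times n x

  ∑-indicator : ∀ {A : Set} (D : A → Bool) (k : Carrier) L → ∑ L (λ x → [ D x ]? k) ≈ times (countB D L) k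
  ∑-indicator D k [] = refl
  ∑-indicator D k (a ∷ L) with D a
  ... | true = +-congˡ (∑-indicator D k L)
  ... | false = trans (+-identityˡ _) (∑-indicator D k L)

  ∑-pick : ∀ {A : Set} (E : A → Bool) (h : A → Carrier) a0 L → (∀ a → E a P.≡ true → a P.≡ a0) → countB E L P.≡ 1 →
    ∑ L (λ a → [ E a ]? (h a)) ≈ h a0
  ∑-pick E h a0 L sound c1 = begin
    ∑ L (λ a → [ E a ]? (h a)) ≈⟨ ∑-cong L (λ {a} _ → pt a) ⟩
    ∑ L (λ a → [ E a ]? (h a0)) ≈⟨ ∑-indicator E (h a0) L ⟩
    times (countB E L) (h a0) ≈⟨ reflexive (P.cong (λ z → times z (h a0)) c1) ⟩
    h a0 + 0# ≈⟨ +-identityʳ _ ⟩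
    h a0 ∎
    where
    pt : ∀ a → [ E a ]? (h a) ≈ [ E a ]? (h a0)
    pt a with E a in e
    ... | true = reflexive (P.cong h (sound a e))
    ... | false = refl

  ∑-pairs : ∀ {A B : Set} (f : A → Carrier) (g : B → Carrier) LA LB →
    ∑ LA f * ∑ LB g ≈ ∑ (pairs LA LB) (λ pr → f (proj₁ pr) * g (proj₂ pr))
  ∑-pairs f g LA LB = begin
    ∑ LA f * ∑ LB g ≈⟨ ∑-*ʳ (∑ LB g) f LA ⟩
    ∑ LA (λ a → f a * ∑ LB g) ≈⟨ ∑-cong LA (λ {a} _ → ∑-*ˡ (f a) g LB) ⟩
    ∑ LA (λ a → ∑ LB (λ b → f a * g b)) ≈⟨ ∑-cong LA (λ {a} _ → sym (∑-map (a ,_) (λ pr → f (proj₁ pr) * g (proj₂ pr)) LB)) ⟩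
    ∑ LA (λ a → ∑ (map (a ,_) LB) (λ pr → f (proj₁ pr) * g (proj₂ pr))) ≈⟨ sym (∑-concatMap (λ a → map (a ,_) LB) _ LA) ⟩
    ∑ (pairs LA LB) (λ pr → f (proj₁ pr) * g (proj₂ pr)) ∎

  -- Summation along a bijection between the Q-part of M and the Pr-part of D with
  -- mutually inverse maps f, g; each image occurs exactly once in the target list.
  module Reindex {A B : Set} (eqA : A → A → Bool) (eqB : B → B → Bool)
    (eqA-sound : ∀ a a' → eqA a a' P.≡ true → a P.≡ a') (eqA-refl : ∀ a → eqA a a P.≡ true)
    (eqB-sound : ∀ b b' → eqB b b' P.≡ true → b P.≡ b') (eqB-refl : ∀ b → eqB b b P.≡ true)
    (M : List B) (D : List A) (Q : B → Bool) (Pr : A → Bool) (f : A → B) (g : B → A) (h : A → Carrier)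
    (decompose-sound : ∀ {b} → b ∈ M → Q b P.≡ true → Pr (g b) P.≡ true × f (g b) P.≡ b × countB (λ a → eqA a (g b)) D P.≡ 1)
    (compose-sound : ∀ {a} → a ∈ D → Pr a P.≡ true → Q (f a) P.≡ true × g (f a) P.≡ a × countB (λ b → eqB b (f a)) M P.≡ 1) where

    pairing-agrees : ∀ {a b} → a ∈ D → b ∈ M → (Q b ∧ eqA a (g b)) P.≡ (Pr a ∧ eqB b (f a))
    pairing-agrees {a} {b} ma mb = ⇔true⇒≡ to from
      where
      to : (Q b ∧ eqA a (g b)) P.≡ true → (Pr a ∧ eqB b (f a)) P.≡ true
      to h1 with ∧-true⁻ h1
      ... | qb , ea with eqA-sound a (g b) ea
      ... | P.refl with decompose-sound mb qb
      ... | pg , fg , _ = ∧-true⁺ pg (P.subst (λ z → eqB b z P.≡ true) (P.sym fg) (eqB-refl b))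
      from : (Pr a ∧ eqB b (f a)) P.≡ true → (Q b ∧ eqA a (g b)) P.≡ true
      from h1 with ∧-true⁻ h1
      ... | pa , eb with eqB-sound b (f a) eb
      ... | P.refl with compose-sound ma pa
      ... | qf , gf , _ = ∧-true⁺ qf (P.subst (λ z → eqA a z P.≡ true) (P.sym gf) (eqA-refl a))

    reindex : ∑ M (λ b → [ Q b ]? (h (g b))) ≈ ∑ D (λ a → [ Pr a ]? (h a))
    reindex = begin
      ∑ M (λ b → [ Q b ]? (h (g b)))
        ≈⟨ ∑-cong M (λ {b} mb → expand b mb) ⟩
      ∑ M (λ b → ∑ D (λ a → [ Q b ∧ eqA a (g b) ]? (h a)))
        ≈⟨ ∑-swap (λ b a → [ Q b ∧ eqA a (g b) ]? (h a)) M D ⟩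
      ∑ D (λ a → ∑ M (λ b → [ Q b ∧ eqA a (g b) ]? (h a)))
        ≈⟨ ∑-cong D (λ {a} ma → ∑-cong M (λ {b} mb → reflexive (P.cong (λ z → [ z ]? (h a)) (pairing-agrees ma mb)))) ⟩
      ∑ D (λ a → ∑ M (λ b → [ Pr a ∧ eqB b (f a) ]? (h a)))
        ≈⟨ ∑-cong D (λ {a} ma → collapse a ma) ⟩
      ∑ D (λ a → [ Pr a ]? (h a)) ∎
      where
      expand : ∀ b → b ∈ M → [ Q b ]? (h (g b)) ≈ ∑ D (λ a → [ Q b ∧ eqA a (g b) ]? (h a))
      expand b mb with Q b in e
      ... | true = sym (∑-pick (λ a → eqA a (g b)) h (g b) D (λ a → eqA-sound a (g b)) (proj₂ (proj₂ (decompose-sound mb e))))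
      ... | false = sym (∑-0 D (λ _ → refl))
      collapse : ∀ a → a ∈ D → ∑ M (λ b → [ Pr a ∧ eqB b (f a) ]? (h a)) ≈ [ Pr a ]? (h a)
      collapse a ma with Pr a in e
      ... | true = ∑-pick (λ b → eqB b (f a)) (λ _ → h a) (f a) M (λ b → eqB-sound b (f a)) (proj₂ (proj₂ (compose-sound ma e)))
      ... | false = ∑-0 M (λ _ → refl)

  pow-+ : ∀ a m n → pow a (m +ℕ n) ≈ pow a m * pow a n
  pow-+ a zero n = sym (*-identityˡ _)
  pow-+ a (suc m) n = trans (*-congˡ (pow-+ a m n)) (sym (*-assoc a _ _))

  pow-1# : ∀ n → pow 1# n ≈ 1#
  pow-1# zero = refl
  pow-1# (suc n) = trans (*-identityˡ _) (pow-1# n)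

  weightOf : (p q x y u v : Carrier) → (a d l r m n : ℕ) → Carrier
  weightOf p q x y u v a d l r m n = pow p a * (pow q d * (pow x l * (pow y r * (pow u m * pow v n))))

  -- The exponents are in the shape produced by Concat.Direct and Concat.Skew.
  weightOf-⊕ : ∀ p q x y u v aA dA lA rA mA nA aB dB lB rB mB nB →
    weightOf p q x y u v (aA +ℕ (1 +ℕ aB)) (dA +ℕ (0 +ℕ dB)) (lA +ℕ lB) (rB +ℕ 0) (mA +ℕ 0) (nB +ℕ nA)
    ≈ p * (weightOf p q x 1# u v aA dA lA rA mA nA * weightOf p q x y 1# v aB dB lB rB mB nB)
  weightOf-⊕ p q x y u v aA dA lA rA mA nA aB dB lB rB mB nB = begin
    weightOf p q x y u v (aA +ℕ (1 +ℕ aB)) (dA +ℕ (0 +ℕ dB)) (lA +ℕ lB) (rB +ℕ 0) (mA +ℕ 0) (nB +ℕ nA)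
      ≈⟨ *-cong (pow-+ p aA (1 +ℕ aB)) (*-cong (pow-+ q dA dB) (*-cong (pow-+ x lA lB) (*-cong (pow-+ y rB 0) (*-cong (pow-+ u mA 0) (pow-+ v nB nA))))) ⟩
    (PA * (p * PB)) * ((QA * QB) * ((XA * XB) * ((YB * 1#) * ((UA * 1#) * (VB * VA)))))
      ≈⟨ CMS.prove 11
          ((var (# 0) ⊕ (var (# 1) ⊕ var (# 2))) ⊕ ((var (# 3) ⊕ var (# 4)) ⊕ ((var (# 5) ⊕ var (# 6)) ⊕ ((var (# 7) ⊕ id) ⊕ ((var (# 8) ⊕ id) ⊕ (var (# 10) ⊕ var (# 9)))))))
          (var (# 1) ⊕ ((var (# 0) ⊕ (var (# 3) ⊕ (var (# 5) ⊕ (id ⊕ (var (# 8) ⊕ var (# 9)))))) ⊕ (var (# 2) ⊕ (var (# 4) ⊕ (var (# 6) ⊕ (var (# 7) ⊕ (id ⊕ var (# 10))))))))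
          (PA ∷ p ∷ PB ∷ QA ∷ QB ∷ XA ∷ XB ∷ YB ∷ UA ∷ VA ∷ VB ∷ []) ⟩
    p * ((PA * (QA * (XA * (1# * (UA * VA))))) * (PB * (QB * (XB * (YB * (1# * VB))))))
      ≈⟨ *-congˡ (*-cong (*-congˡ (*-congˡ (*-congˡ (*-congʳ (sym (pow-1# rA)))))) (*-congˡ (*-congˡ (*-congˡ (*-congˡ (*-congʳ (sym (pow-1# mB)))))))) ⟩
    p * (weightOf p q x 1# u v aA dA lA rA mA nA * weightOf p q x y 1# v aB dB lB rB mB nB) ∎
    where
    PA = pow p aA ; PB = pow p aB ; QA = pow q dA ; QB = pow q dB ; XA = pow x lA ; XB = pow x lB
    YB = pow y rB ; UA = pow u mA ; VA = pow v nA ; VB = pow v nB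

  weightOf-⊖ : ∀ p q x y u v aA dA lA rA mA nA aB dB lB rB mB nB →
    weightOf p q x y u v (aA +ℕ (0 +ℕ aB)) (dA +ℕ (1 +ℕ dB)) (lA +ℕ 0) (rB +ℕ rA) (mA +ℕ mB) (nB +ℕ 0)
    ≈ q * (weightOf p q x y u 1# aA dA lA rA mA nA * weightOf p q 1# y u v aB dB lB rB mB nB)
  weightOf-⊖ p q x y u v aA dA lA rA mA nA aB dB lB rB mB nB = begin
    weightOf p q x y u v (aA +ℕ (0 +ℕ aB)) (dA +ℕ (1 +ℕ dB)) (lA +ℕ 0) (rB +ℕ rA) (mA +ℕ mB) (nB +ℕ 0)
      ≈⟨ *-cong (pow-+ p aA aB) (*-cong (pow-+ q dA (1 +ℕ dB)) (*-cong (pow-+ x lA 0) (*-cong (pow-+ y rB rA) (*-cong (pow-+ u mA mB) (pow-+ v nB 0))))) ⟩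
    (PA * PB) * ((QA * (q * QB)) * ((XA * 1#) * ((YB * YA) * ((UA * UB) * (VB * 1#)))))
      ≈⟨ CMS.prove 11
          ((var (# 0) ⊕ var (# 1)) ⊕ ((var (# 2) ⊕ (var (# 3) ⊕ var (# 4))) ⊕ ((var (# 5) ⊕ id) ⊕ ((var (# 7) ⊕ var (# 6)) ⊕ ((var (# 8) ⊕ var (# 9)) ⊕ (var (# 10) ⊕ id))))))
          (var (# 3) ⊕ ((var (# 0) ⊕ (var (# 2) ⊕ (var (# 5) ⊕ (var (# 6) ⊕ (var (# 8) ⊕ id))))) ⊕ (var (# 1) ⊕ (var (# 4) ⊕ (id ⊕ (var (# 7) ⊕ (var (# 9) ⊕ var (# 10))))))))
          (PA ∷ PB ∷ QA ∷ q ∷ QB ∷ XA ∷ YA ∷ YB ∷ UA ∷ UB ∷ VB ∷ []) ⟩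
    q * ((PA * (QA * (XA * (YA * (UA * 1#))))) * (PB * (QB * (1# * (YB * (UB * VB))))))
      ≈⟨ *-congˡ (*-cong (*-congˡ (*-congˡ (*-congˡ (*-congˡ (*-congˡ (sym (pow-1# nA))))))) (*-congˡ (*-congˡ (*-congʳ (sym (pow-1# lB)))))) ⟩
    q * (weightOf p q x y u 1# aA dA lA rA mA nA * weightOf p q 1# y u v aB dB lB rB mB nB) ∎
    where
    PA = pow p aA ; PB = pow p aB ; QA = pow q dA ; QB = pow q dB ; XA = pow x lA
    YA = pow y rA ; YB = pow y rB ; UA = pow u mA ; UB = pow u mB ; VB = pow v nB

  weight-one : ∀ p q x y u v → weight p q x y u v (1 ∷ []) ≈ x * y * u * v
  weight-one p q x y u v = CMS.prove 4
    (id ⊕ (id ⊕ ((var (# 0) ⊕ id) ⊕ ((var (# 1) ⊕ id) ⊕ ((var (# 2) ⊕ id) ⊕ (var (# 3) ⊕ id))))))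
    (((var (# 0) ⊕ var (# 1)) ⊕ var (# 2)) ⊕ var (# 3)) (x ∷ y ∷ u ∷ v ∷ [])

  weightOf-cong : ∀ p q x y u v {a a' d d' l l' r r' m m' n n'} → a ≡ a' → d ≡ d' → l ≡ l' → r ≡ r' → m ≡ m' → n ≡ n' →
    weightOf p q x y u v a d l r m n ≡ weightOf p q x y u v a' d' l' r' m' n'
  weightOf-cong p q x y u v P.refl P.refl P.refl P.refl P.refl P.refl = P.refl

  weight-std : ∀ p q x y u v A → weight p q x y u v (std A) ≡ weightOf p q x y u v (asc A) (des A) (lmax A) (rmax A) (lmin A) (rmin A)
  weight-std p q x y u v A = weightOf-cong p q x y u v asc-inv des-inv lmax-inv rmax-inv lmin-inv rmin-inv
    where open Relabel {rank A} {A} (rank-preservesOrder A)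

  weight-⊕ : ∀ p q x y u v T D → 0 < length T → 0 < length D → AllLess T D →
    weight p q x y u v (T ++ D) ≈ p * (weight p q x 1# u v (std T) * weight p q x y 1# v (std D))
  weight-⊕ p q x y u v (x0 ∷ a) (y0 ∷ b) _ _ al =
    trans (reflexive (weightOf-cong p q x y u v asc-++ des-++ lmax-++ rmax-++ lmin-++ rmin-++))
      (trans (weightOf-⊕ p q x y u v (asc A) (des A) (lmax A) (rmax A) (lmin A) (rmin A) (asc B) (des B) (lmax B) (rmax B) (lmin B) (rmin B))
        (reflexive (cong (p *_) (cong₂ _*_ (P.sym (weight-std p q x 1# u v A)) (P.sym (weight-std p q x y 1# v B))))))
    where
    open Concat x0 a y0 b
    open Concat.Direct x0 a y0 b al

  weight-⊖ : ∀ p q x y u v T D → 0 < length T → 0 < length D → AllLess D T →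
    weight p q x y u v (T ++ D) ≈ q * (weight p q x y u 1# (std T) * weight p q 1# y u v (std D))
  weight-⊖ p q x y u v (x0 ∷ a) (y0 ∷ b) _ _ al =
    trans (reflexive (weightOf-cong p q x y u v asc-++ des-++ lmax-++ rmax-++ lmin-++ rmin-++))
      (trans (weightOf-⊖ p q x y u v (asc A) (des A) (lmax A) (rmax A) (lmin A) (rmin A) (asc B) (des B) (lmax B) (rmax B) (lmin B) (rmin B))
        (reflexive (cong (q *_) (cong₂ _*_ (P.sym (weight-std p q x y u 1# A)) (P.sym (weight-std p q 1# y u v B))))))
    where
    open Concat x0 a y0 b
    open Concat.Skew x0 a y0 b al

  ∑-unique : ∀ N (D : ℕ → Bool) (F : ℕ → Carrier) i → i < N → D i ≡ true → (∀ j → D j ≡ true → j ≡ i) →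
    ∑ (upTo N) (λ j → [ D j ]? (F j)) ≈ F i
  ∑-unique N D F i lt di uniq = ∑-pick D F i (upTo N) uniq
    (P.trans (countB-cong (upTo N) (λ {j} _ → ⇔true⇒≡ (λ dj → ≡⇒≡ᵇ-true (uniq j dj)) (λ ej → subst (λ z → D z ≡ true) (P.sym (≡ᵇ-true⇒≡ ej)) di)))
             (count-upTo N i lt))

  ∑-none : ∀ L (D : ℕ → Bool) (F : ℕ → Carrier) → (∀ j → D j ≡ false) → ∑ L (λ j → [ D j ]? (F j)) ≈ 0#
  ∑-none L D F h = ∑-0 L (λ {j} _ → reflexive (cong (λ z → [ z ]? (F j)) (h j)))

  ∑-isOne : ∀ k n → ∑ (perms n) (λ w → [ eqList w (1 ∷ []) ]? k) ≈ monoT k n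
  ∑-isOne k n = trans (∑-indicator (λ w → eqList w (1 ∷ [])) k (perms n)) (lem n)
    where
    lem : ∀ n → times (countB (λ w → eqList w (1 ∷ [])) (perms n)) k ≈ monoT k n
    lem n rewrite perms-count-one n with n ≡ᵇ 1
    ... | true = +-identityʳ k
    ... | false = refl

  indicator-∧-* : ∀ b1 b2 k a b → [ b1 ∧ b2 ]? (k * (a * b)) ≈ k * ([ b1 ]? a * [ b2 ]? b)
  indicator-∧-* true true k a b = refl
  indicator-∧-* true false k a b = sym (trans (*-congˡ (zeroʳ a)) (zeroʳ k))
  indicator-∧-* false b2 k a b = sym (trans (*-congˡ (zeroˡ _)) (zeroʳ k))

  +≈+⇒≈-+ : ∀ X I S O → X + I ≈ S + O → X ≈ (S - I) + O
  +≈+⇒≈-+ X I S O h = begin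
    X ≈⟨ sym (+-identityʳ X) ⟩
    X + 0# ≈⟨ +-congˡ (sym (-‿inverseʳ I)) ⟩
    X + (I + - I) ≈⟨ sym (+-assoc X I (- I)) ⟩
    (X + I) + - I ≈⟨ +-congʳ h ⟩
    (S + O) + - I ≈⟨ +-assoc S O (- I) ⟩
    S + (O + - I) ≈⟨ +-congˡ (+-comm O (- I)) ⟩
    S + (- I + O) ≈⟨ sym (+-assoc S (- I) O) ⟩
    (S + - I) + O ∎

  -- Summing over canonical decompositions

  module Terms (p q x y u v : Carrier) where
    W = weight p q x y u v
    directTerm : ℕ → List ℕ → Carrier
    directTerm i w = p * (weight p q x 1# u v (std (take i w)) * weight p q x y 1# v (std (drop i w)))
    skewTerm : ℕ → List ℕ → Carrier
    skewTerm i w = q * (weight p q x y u 1# (std (take i w)) * weight p q 1# y u v (std (drop i w)))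
    directTerms skewTerms : ℕ → List ℕ → Carrier
    directTerms n w = ∑ (upTo (suc n)) (λ i → [ isDirectDecompAt i w ]? (directTerm i w))
    skewTerms n w = ∑ (upTo (suc n)) (λ i → [ isSkewDecompAt i w ]? (skewTerm i w))
    X = x * y * u * v

    weight-directDecomp : ∀ w i → DirectDecompAt i w → W w ≈ directTerm i w
    weight-directDecomp w i (i>0 , lt , al , _) =
      trans (reflexive (cong W (P.sym (take++drop≡id i w))))
        (weight-⊕ p q x y u v (take i w) (drop i w) (proj₁ (take-drop-nonempty w i i>0 lt)) (proj₂ (take-drop-nonempty w i i>0 lt)) (allLess⇒AllLess _ _ al))

    weight-skewDecomp : ∀ w i → SkewDecompAt i w → W w ≈ skewTerm i w
    weight-skewDecomp w i (i>0 , lt , al , _) =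
      trans (reflexive (cong W (P.sym (take++drop≡id i w))))
        (weight-⊖ p q x y u v (take i w) (drop i w) (proj₁ (take-drop-nonempty w i i>0 lt)) (proj₂ (take-drop-nonempty w i i>0 lt)) (allLess⇒AllLess _ _ al))

    terms-one : ∀ n → directTerms n (1 ∷ []) ≈ 0# × skewTerms n (1 ∷ []) ≈ 0#
    terms-one n = ∑-none (upTo (suc n)) (λ i → isDirectDecompAt i (1 ∷ [])) (λ i → directTerm i (1 ∷ [])) isDirectDecompAt-one , ∑-none (upTo (suc n)) (λ i → isSkewDecompAt i (1 ∷ [])) (λ i → skewTerm i (1 ∷ [])) isSkewDecompAt-one

    terms-notSep : ∀ n w → isSep w ≡ false → directTerms n w ≈ 0# × skewTerms n w ≈ 0#
    terms-notSep n w es =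
      ∑-none (upTo (suc n)) (λ i → isDirectDecompAt i w) (λ i → directTerm i w) (λ i → fa i) , ∑-none (upTo (suc n)) (λ i → isSkewDecompAt i w) (λ i → skewTerm i w) (λ i → fb i)
      where
      fa : ∀ i → isDirectDecompAt i w ≡ false
      fa i with isDirectDecompAt i w in e
      ... | false = P.refl
      ... | true = ⊥-elim (true≢false (P.trans (P.sym (proj₁ (directDecomp⇒reducible i w e))) es))
      fb : ∀ i → isSkewDecompAt i w ≡ false
      fb i with isSkewDecompAt i w in e
      ... | false = P.refl
      ... | true = ⊥-elim (true≢false (P.trans (P.sym (proj₁ (skewDecomp⇒irreducible i w e))) es))

    terms-reducible : ∀ n w → length w ≡ n → isSep w ≡ true → isIrr w ≡ false → (W w ≈ directTerms n w) × skewTerms n w ≈ 0#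
    terms-reducible n w len es ei with reducible⇒directDecomp w es ei
    ... | i0 , lt0 , ab0 =
      trans (weight-directDecomp w i0 (isDirectDecompAt⁻ i0 w ab0)) (sym (∑-unique (suc n) (λ i → isDirectDecompAt i w) (λ i → directTerm i w) i0
        (m<n⇒m<1+n (subst (i0 <_) len lt0)) ab0 (λ j abj → directDecomp-unique j i0 w abj ab0))) ,
      ∑-none (upTo (suc n)) (λ i → isSkewDecompAt i w) (λ i → skewTerm i w) fb
      where
      fb : ∀ i → isSkewDecompAt i w ≡ false
      fb i with isSkewDecompAt i w in e
      ... | false = P.refl
      ... | true = ⊥-elim (direct-skew-exclusive i0 i w ab0 e)

    terms-irreducible : ∀ n w → length w ≡ n → isSep w ≡ true → isOne w ≡ false → isIrr w ≡ true → (W w ≈ skewTerms n w) × directTerms n w ≈ 0#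
    terms-irreducible n w len es one ei with irreducible⇒skewDecomp w es one ei
    ... | i0 , lt0 , bb0 =
      trans (weight-skewDecomp w i0 (isSkewDecompAt⁻ i0 w bb0)) (sym (∑-unique (suc n) (λ i → isSkewDecompAt i w) (λ i → skewTerm i w) i0
        (m<n⇒m<1+n (subst (i0 <_) len lt0)) bb0 (λ j bbj → skewDecomp-unique j i0 w bbj bb0))) ,
      ∑-none (upTo (suc n)) (λ i → isDirectDecompAt i w) (λ i → directTerm i w) fa
      where
      fa : ∀ i → isDirectDecompAt i w ≡ false
      fa i with isDirectDecompAt i w in e
      ... | false = P.refl
      ... | true = ⊥-elim (true≢false (P.trans (P.sym ei) (proj₂ (directDecomp⇒reducible i w e))))

    sepIndicator-split : ∀ n w → length w ≡ n → [ isSep w ]? (W w) ≈ [ eqList w (1 ∷ []) ]? X + (directTerms n w + skewTerms n w)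
    sepIndicator-split n w len with eqList w (1 ∷ []) in e1
    ... | true with eqList⇒≡ w _ e1
    ... | P.refl = begin
      W (1 ∷ []) ≈⟨ weight-one p q x y u v ⟩
      X ≈⟨ sym (+-identityʳ X) ⟩
      X + 0# ≈⟨ +-congˡ (sym (+-identityʳ 0#)) ⟩
      X + (0# + 0#) ≈⟨ +-congˡ (sym (+-cong (proj₁ (terms-one n)) (proj₂ (terms-one n)))) ⟩
      X + (directTerms n (1 ∷ []) + skewTerms n (1 ∷ [])) ∎
    sepIndicator-split n w len | false with isSep w in es
    ... | false = sym (trans (+-identityˡ _) (trans (+-cong (proj₁ (terms-notSep n w es)) (proj₂ (terms-notSep n w es))) (+-identityˡ 0#)))
    ... | true with isIrr w in ei
    ... | false = let (h1 , h2) = terms-reducible n w len es ei in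
      trans h1 (sym (trans (+-identityˡ _) (trans (+-congˡ h2) (+-identityʳ _))))
    ... | true = let (h1 , h2) = terms-irreducible n w len es (P.trans (P.sym (eqList-one w)) e1) ei in
      trans h1 (sym (trans (+-identityˡ _) (trans (+-congʳ h2) (+-identityˡ _))))

    sepIrrIndicator-split : ∀ n w → length w ≡ n → [ isSep w ∧ isIrr w ]? (W w) ≈ [ eqList w (1 ∷ []) ]? X + skewTerms n w
    sepIrrIndicator-split n w len with eqList w (1 ∷ []) in e1
    ... | true with eqList⇒≡ w _ e1
    ... | P.refl = trans (weight-one p q x y u v) (sym (trans (+-congˡ (proj₂ (terms-one n))) (+-identityʳ X)))
    sepIrrIndicator-split n w len | false with isSep w in es
    ... | false = sym (trans (+-identityˡ _) (proj₂ (terms-notSep n w es)))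
    ... | true with isIrr w in ei
    ... | false = sym (trans (+-identityˡ _) (proj₂ (terms-reducible n w len es ei)))
    ... | true = trans (proj₁ (terms-irreducible n w len es (P.trans (P.sym (eqList-one w)) e1) ei)) (sym (+-identityˡ _))

  module Recurrences (p q x y u v : Carrier) where
    open Terms p q x y u v

    module DirectAt (n i : ℕ) (le : i ≤ n) where
      D = pairs (perms i) (perms (n ∸ i))
      compose : List ℕ × List ℕ → List ℕ
      compose ab = proj₁ ab ++ map (λ z → z +ℕ i) (proj₂ ab)
      decompose : List ℕ → List ℕ × List ℕ
      decompose w = std (take i w) , std (drop i w)
      W1 = weight p q x 1# u v
      W2 = weight p q x y 1# v
      term : List ℕ × List ℕ → Carrier
      term ab = p * (W1 (proj₁ ab) * W2 (proj₂ ab))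
      admissible : List ℕ × List ℕ → Bool
      admissible ab = isSep (proj₁ ab) ∧ (isSep (proj₂ ab) ∧ isIrr (proj₂ ab))

      decompose-sound : ∀ {b} → b ∈ perms n → isDirectDecompAt i b ≡ true → admissible (decompose b) ≡ true × compose (decompose b) ≡ b × countB (λ a → eqPair a (decompose b)) D ≡ 1
      decompose-sound {b} mb h with isDirectDecompAt⁻ i b h
      ... | i>0 , lt , al , sT , sD , irrD =
        ∧-true⁺ sT (∧-true⁺ sD irrD) , reassemble ,
        P.trans (pairs-count (perms i) (perms (n ∸ i)) _ _) (cong₂ _*ℕ_ (perms-count i _ front-isPerm) (perms-count (n ∸ i) _ back-isPerm))
        where
        open Split (∈-perms⇒IsPerm n mb) le
        open Split.Plus (∈-perms⇒IsPerm n mb) le (allLess⇒AllLess _ _ al)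

      compose-sound : ∀ {a} → a ∈ D → admissible a ≡ true → isDirectDecompAt i (compose a) ≡ true × decompose (compose a) ≡ a × countB (λ b → eqList b (compose a)) (perms n) ≡ 1
      compose-sound {α , β} m pr =
        isDirectDecompAt⁺ i π (i>0 , ltπ , alπ , Separable-≡ (P.sym stdT) sα , Separable-≡ (P.sym stdD) sβ , subst (λ z → isIrr z ≡ true) (P.sym stdD) iβ) ,
        cong₂ _,_ stdT stdD ,
        perms-count n π (subst (λ z → IsPerm z π) (m+[n∸m]≡n le) sum-isPerm)
        where
        mα = proj₁ (∈-pairs (perms i) (perms (n ∸ i)) m)
        mβ = proj₂ (∈-pairs (perms i) (perms (n ∸ i)) m)
        pa = ∈-perms⇒IsPerm i mα
        pb = ∈-perms⇒IsPerm (n ∸ i) mβ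
        open Build pa pb
        open Build.Plus pa pb
        sα = proj₁ (∧-true⁻ {isSep α} pr)
        sβ = proj₁ (∧-true⁻ {isSep β} (proj₂ (∧-true⁻ {isSep α} pr)))
        iβ = proj₂ (∧-true⁻ {isSep β} (proj₂ (∧-true⁻ {isSep α} pr)))
        i>0 : 0 < i
        i>0 = subst (0 <_) (proj₁ pa) (isSep⇒nonempty α sα)
        ltπ : i < length π
        ltπ = subst (i <_) (P.sym (proj₁ sum-isPerm)) (m<m+n i (subst (0 <_) (proj₁ pb) (isSep⇒nonempty β sβ)))
        alπ : allLess (take i π) (drop i π) ≡ true
        alπ = subst₂ (λ a b → allLess a b ≡ true) (P.sym takeπ) (P.sym dropπ) (AllLess⇒allLess α β' al)

      open Reindex eqPair eqList eqPair⇒≡ eqPair-refl eqList⇒≡ eqList-refl (perms n) D (isDirectDecompAt i) admissible compose decompose term decompose-sound compose-sound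

      ∑-directDecompAt : ∑ (perms n) (λ w → [ isDirectDecompAt i w ]? (directTerm i w)) ≈ p * (Sc i p q x 1# u v * Ic (n ∸ i) p q x y 1# v)
      ∑-directDecompAt = begin
        ∑ (perms n) (λ w → [ isDirectDecompAt i w ]? (term (decompose w))) ≈⟨ reindex ⟩
        ∑ D (λ ab → [ admissible ab ]? (term ab)) ≈⟨ ∑-cong D (λ {ab} _ → indicator-∧-* (isSep (proj₁ ab)) (isSep (proj₂ ab) ∧ isIrr (proj₂ ab)) p _ _) ⟩
        ∑ D (λ ab → p * ([ isSep (proj₁ ab) ]? (W1 (proj₁ ab)) * [ isSep (proj₂ ab) ∧ isIrr (proj₂ ab) ]? (W2 (proj₂ ab)))) ≈⟨ sym (∑-*ˡ p _ D) ⟩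
        p * ∑ D (λ ab → [ isSep (proj₁ ab) ]? (W1 (proj₁ ab)) * [ isSep (proj₂ ab) ∧ isIrr (proj₂ ab) ]? (W2 (proj₂ ab))) ≈⟨ *-congˡ (sym (∑-pairs (λ α → [ isSep α ]? (W1 α)) (λ β → [ isSep β ∧ isIrr β ]? (W2 β)) (perms i) (perms (n ∸ i)))) ⟩
        p * (∑ (perms i) (λ α → [ isSep α ]? (W1 α)) * ∑ (perms (n ∸ i)) (λ β → [ isSep β ∧ isIrr β ]? (W2 β)))
          ≈⟨ *-congˡ (*-cong (sym (∑-filterB isSep W1 (perms i))) (sym (∑-filterB (λ β → isSep β ∧ isIrr β) W2 (perms (n ∸ i))))) ⟩
        p * (Sc i p q x 1# u v * Ic (n ∸ i) p q x y 1# v) ∎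

    W3 = weight p q x y u 1#
    W4 = weight p q 1# y u v

    skewLeftCoeff : ℕ → Carrier
    skewLeftCoeff i = Sc i p q x y u 1# - Ic i p q x y u 1# + monoT (x * y * u) i

    ∑-isSepReducibleOrOne : ∀ i → ∑ (perms i) (λ α → [ isSepReducibleOrOne α ]? (W3 α)) ≈ skewLeftCoeff i
    ∑-isSepReducibleOrOne i = trans (+≈+⇒≈-+ _ _ _ _ (begin
        ∑ (perms i) (λ α → [ isSepReducibleOrOne α ]? (W3 α)) + ∑ (perms i) (λ α → [ isSep α ∧ isIrr α ]? (W3 α))
          ≈⟨ sym (∑-+ (λ α → [ isSepReducibleOrOne α ]? (W3 α)) (λ α → [ isSep α ∧ isIrr α ]? (W3 α)) (perms i)) ⟩
        ∑ (perms i) (λ α → [ isSepReducibleOrOne α ]? (W3 α) + [ isSep α ∧ isIrr α ]? (W3 α))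
          ≈⟨ ∑-cong (perms i) (λ {α} _ → pt α) ⟩
        ∑ (perms i) (λ α → [ isSep α ]? (W3 α) + [ eqList α (1 ∷ []) ]? (W3 α))
          ≈⟨ ∑-+ (λ α → [ isSep α ]? (W3 α)) (λ α → [ eqList α (1 ∷ []) ]? (W3 α)) (perms i) ⟩
        ∑ (perms i) (λ α → [ isSep α ]? (W3 α)) + ∑ (perms i) (λ α → [ eqList α (1 ∷ []) ]? (W3 α))
          ≈⟨ +-cong (sym (∑-filterB isSep W3 (perms i))) (trans (∑-cong (perms i) (λ {α} _ → one α)) (∑-isOne (x * y * u) i)) ⟩
        Sc i p q x y u 1# + monoT (x * y * u) i ∎))
      (+-congʳ (+-congˡ (-‿cong (sym (∑-filterB (λ β → isSep β ∧ isIrr β) W3 (perms i))))))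
      where
      -- 1 is irreducible, so it is counted on both sides.
      pt : ∀ α → [ isSepReducibleOrOne α ]? (W3 α) + [ isSep α ∧ isIrr α ]? (W3 α) ≈ [ isSep α ]? (W3 α) + [ eqList α (1 ∷ []) ]? (W3 α)
      pt α with eqList α (1 ∷ []) in e
      ... | true with eqList⇒≡ α _ e
      ... | P.refl = refl
      pt α | false rewrite isSepReducibleOrOne-notOne α (P.trans (P.sym (eqList-one α)) e) with isSep α | isIrr α
      ... | true | true = +-comm _ _
      ... | true | false = refl
      ... | false | _ = refl
      one : ∀ α → [ eqList α (1 ∷ []) ]? (W3 α) ≈ [ eqList α (1 ∷ []) ]? (x * y * u)
      one α with eqList α (1 ∷ []) in e
      ... | false = refl
      ... | true with eqList⇒≡ α _ e
      ... | P.refl = trans (weight-one p q x y u 1#) (*-identityʳ _)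

    module SkewAt (n i : ℕ) (le : i ≤ n) where
      D = pairs (perms i) (perms (n ∸ i))
      j = n ∸ i
      compose : List ℕ × List ℕ → List ℕ
      compose ab = map (λ z → z +ℕ j) (proj₁ ab) ++ proj₂ ab
      decompose : List ℕ → List ℕ × List ℕ
      decompose w = std (take i w) , std (drop i w)
      term : List ℕ × List ℕ → Carrier
      term ab = q * (W3 (proj₁ ab) * W4 (proj₂ ab))
      admissible : List ℕ × List ℕ → Bool
      admissible ab = isSepReducibleOrOne (proj₁ ab) ∧ isSep (proj₂ ab)

      decompose-sound : ∀ {b} → b ∈ perms n → isSkewDecompAt i b ≡ true → admissible (decompose b) ≡ true × compose (decompose b) ≡ b × countB (λ a → eqPair a (decompose b)) D ≡ 1
      decompose-sound {b} mb h with isSkewDecompAt⁻ i b h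
      ... | i>0 , lt , al , sk , sD =
        ∧-true⁺ sk sD , reassemble ,
        P.trans (pairs-count (perms i) (perms (n ∸ i)) _ _) (cong₂ _*ℕ_ (perms-count i _ front-isPerm) (perms-count (n ∸ i) _ back-isPerm))
        where
        open Split (∈-perms⇒IsPerm n mb) le
        open Split.Minus (∈-perms⇒IsPerm n mb) le (allLess⇒AllLess _ _ al)

      compose-sound : ∀ {a} → a ∈ D → admissible a ≡ true → isSkewDecompAt i (compose a) ≡ true × decompose (compose a) ≡ a × countB (λ b → eqList b (compose a)) (perms n) ≡ 1
      compose-sound {α , β} m pr =
        isSkewDecompAt⁺ i π (i>0 , ltπ , alπ , subst (λ z → isSepReducibleOrOne z ≡ true) (P.sym stdT) kα , Separable-≡ (P.sym stdD) sβ) ,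
        cong₂ _,_ stdT stdD ,
        perms-count n π (subst (λ z → IsPerm z π) (m+[n∸m]≡n le) sum-isPerm)
        where
        mα = proj₁ (∈-pairs (perms i) (perms (n ∸ i)) m)
        mβ = proj₂ (∈-pairs (perms i) (perms (n ∸ i)) m)
        pa = ∈-perms⇒IsPerm i mα
        pb = ∈-perms⇒IsPerm (n ∸ i) mβ
        open Build pa pb
        open Build.Minus pa pb
        kα = proj₁ (∧-true⁻ {isSepReducibleOrOne α} pr)
        sβ = proj₂ (∧-true⁻ {isSepReducibleOrOne α} pr)
        i>0 : 0 < i
        i>0 = subst (0 <_) (proj₁ pa) (isSep⇒nonempty α (isSepReducibleOrOne⇒Separable α kα))
        ltπ : i < length π
        ltπ = subst (i <_) (P.sym (proj₁ sum-isPerm)) (m<m+n i (subst (0 <_) (proj₁ pb) (isSep⇒nonempty β sβ)))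
        alπ : allLess (drop i π) (take i π) ≡ true
        alπ = subst₂ (λ a b → allLess a b ≡ true) (P.sym dropπ) (P.sym takeπ) (AllLess⇒allLess β α' al)

      open Reindex eqPair eqList eqPair⇒≡ eqPair-refl eqList⇒≡ eqList-refl (perms n) D (isSkewDecompAt i) admissible compose decompose term decompose-sound compose-sound

      ∑-skewDecompAt : ∑ (perms n) (λ w → [ isSkewDecompAt i w ]? (skewTerm i w)) ≈ q * (skewLeftCoeff i * Sc (n ∸ i) p q 1# y u v)
      ∑-skewDecompAt = begin
        ∑ (perms n) (λ w → [ isSkewDecompAt i w ]? (term (decompose w))) ≈⟨ reindex ⟩
        ∑ D (λ ab → [ admissible ab ]? (term ab)) ≈⟨ ∑-cong D (λ {ab} _ → indicator-∧-* (isSepReducibleOrOne (proj₁ ab)) (isSep (proj₂ ab)) q _ _) ⟩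
        ∑ D (λ ab → q * ([ isSepReducibleOrOne (proj₁ ab) ]? (W3 (proj₁ ab)) * [ isSep (proj₂ ab) ]? (W4 (proj₂ ab)))) ≈⟨ sym (∑-*ˡ q _ D) ⟩
        q * ∑ D (λ ab → [ isSepReducibleOrOne (proj₁ ab) ]? (W3 (proj₁ ab)) * [ isSep (proj₂ ab) ]? (W4 (proj₂ ab))) ≈⟨ *-congˡ (sym (∑-pairs (λ α → [ isSepReducibleOrOne α ]? (W3 α)) (λ β → [ isSep β ]? (W4 β)) (perms i) (perms (n ∸ i)))) ⟩
        q * (∑ (perms i) (λ α → [ isSepReducibleOrOne α ]? (W3 α)) * ∑ (perms (n ∸ i)) (λ β → [ isSep β ]? (W4 β)))
          ≈⟨ *-congˡ (*-cong (∑-isSepReducibleOrOne i) (sym (∑-filterB isSep W4 (perms (n ∸ i))))) ⟩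
        q * (skewLeftCoeff i * Sc (n ∸ i) p q 1# y u v) ∎

    convA : ℕ → Carrier
    convA n = conv (λ i → Sc i p q x 1# u v) (λ j → Ic j p q x y 1# v) n
    convB : ℕ → Carrier
    convB n = conv skewLeftCoeff (λ j → Sc j p q 1# y u v) n

    ∑-directTerms : ∀ n → ∑ (upTo (suc n)) (λ i → ∑ (perms n) (λ w → [ isDirectDecompAt i w ]? (directTerm i w))) ≈ p * convA n
    ∑-directTerms n = trans (∑-cong (upTo (suc n)) (λ {i} mi → DirectAt.∑-directDecompAt n i (≤-pred (∈-upTo⁻ mi))))
                   (sym (∑-*ˡ p (λ i → Sc i p q x 1# u v * Ic (n ∸ i) p q x y 1# v) (upTo (suc n))))

    ∑-skewTerms : ∀ n → ∑ (upTo (suc n)) (λ i → ∑ (perms n) (λ w → [ isSkewDecompAt i w ]? (skewTerm i w))) ≈ q * convB n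
    ∑-skewTerms n = trans (∑-cong (upTo (suc n)) (λ {i} mi → SkewAt.∑-skewDecompAt n i (≤-pred (∈-upTo⁻ mi))))
                   (sym (∑-*ˡ q (λ i → skewLeftCoeff i * Sc (n ∸ i) p q 1# y u v) (upTo (suc n))))

    S-recurrence : ∀ n → Sc n p q x y u v ≈ monoT X n + p * convA n + q * convB n
    S-recurrence n = begin
      Sc n p q x y u v ≈⟨ ∑-filterB isSep W (perms n) ⟩
      ∑ (perms n) (λ w → [ isSep w ]? (W w)) ≈⟨ ∑-cong (perms n) (λ {w} mw → sepIndicator-split n w (proj₁ (∈-perms⇒IsPerm n mw))) ⟩
      ∑ (perms n) (λ w → [ eqList w (1 ∷ []) ]? X + (directTerms n w + skewTerms n w)) ≈⟨ ∑-+ (λ w → [ eqList w (1 ∷ []) ]? X) (λ w → directTerms n w + skewTerms n w) (perms n) ⟩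
      ∑ (perms n) (λ w → [ eqList w (1 ∷ []) ]? X) + ∑ (perms n) (λ w → directTerms n w + skewTerms n w) ≈⟨ +-cong (∑-isOne X n) (∑-+ (directTerms n) (skewTerms n) (perms n)) ⟩
      monoT X n + (∑ (perms n) (directTerms n) + ∑ (perms n) (skewTerms n))
        ≈⟨ +-congˡ (+-cong (∑-swap (λ w i → [ isDirectDecompAt i w ]? (directTerm i w)) (perms n) (upTo (suc n)))
                             (∑-swap (λ w i → [ isSkewDecompAt i w ]? (skewTerm i w)) (perms n) (upTo (suc n)))) ⟩
      monoT X n + (∑ (upTo (suc n)) (λ i → ∑ (perms n) (λ w → [ isDirectDecompAt i w ]? (directTerm i w))) + ∑ (upTo (suc n)) (λ i → ∑ (perms n) (λ w → [ isSkewDecompAt i w ]? (skewTerm i w))))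
        ≈⟨ +-congˡ (+-cong (∑-directTerms n) (∑-skewTerms n)) ⟩
      monoT X n + (p * convA n + q * convB n) ≈⟨ sym (+-assoc _ _ _) ⟩
      monoT X n + p * convA n + q * convB n ∎

    I-recurrence : ∀ n → Ic n p q x y u v ≈ monoT X n + q * convB n
    I-recurrence n = begin
      Ic n p q x y u v ≈⟨ ∑-filterB (λ w → isSep w ∧ isIrr w) W (perms n) ⟩
      ∑ (perms n) (λ w → [ isSep w ∧ isIrr w ]? (W w)) ≈⟨ ∑-cong (perms n) (λ {w} mw → sepIrrIndicator-split n w (proj₁ (∈-perms⇒IsPerm n mw))) ⟩
      ∑ (perms n) (λ w → [ eqList w (1 ∷ []) ]? X + skewTerms n w) ≈⟨ ∑-+ (λ w → [ eqList w (1 ∷ []) ]? X) (skewTerms n) (perms n) ⟩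
      ∑ (perms n) (λ w → [ eqList w (1 ∷ []) ]? X) + ∑ (perms n) (skewTerms n)
        ≈⟨ +-cong (∑-isOne X n) (∑-swap (λ w i → [ isSkewDecompAt i w ]? (skewTerm i w)) (perms n) (upTo (suc n))) ⟩
      monoT X n + ∑ (upTo (suc n)) (λ i → ∑ (perms n) (λ w → [ isSkewDecompAt i w ]? (skewTerm i w))) ≈⟨ +-congˡ (∑-skewTerms n) ⟩
      monoT X n + q * convB n ∎

theorem1 : ∀ {c ℓ} (R : CommutativeRing c ℓ) →
    let open CommutativeRing R
        open GF R
    in ∀ (p q x y u v : Carrier) (n : ℕ) →
      (Sc n p q x y u v ≈
        (monoT (x * y * u * v) n
         + p * conv (λ i → Sc i p q x 1# u v) (λ j → Ic j p q x y 1# v) n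
         + q * conv (λ i → Sc i p q x y u 1# - Ic i p q x y u 1# + monoT (x * y * u) i)
                    (λ j → Sc j p q 1# y u v) n))
      ×
      (Ic n p q x y u v ≈
        (monoT (x * y * u * v) n
         + q * conv (λ i → Sc i p q x y u 1# - Ic i p q x y u 1# + monoT (x * y * u) i)
                    (λ j → Sc j p q 1# y u v) n))
theorem1 R p q x y u v n = S-recurrence n , I-recurrence n
  where open Series R; open Recurrences p q x y u v
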